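{- Let $G$ be a finite simple graph and $k$ a positive integer. If $r^*\in R_{\max}(G,k)$, then (i) $r^*$ is a proper restraint; and (ii) $A_7''(G,r^*)=\min\{A_7''(G,r): r \text{ is a proper } k\text{ -restraint on } G\}$, where for a restraint $r$, $$A_7''(G,r)=-\sum_{u\in V(G)}\ \sum_{\{v,w\}\subseteq N_G(u),\ v\neq w}|r(v)\cap r(w)|$$ (inner sum over unordered pairs of distinct neighbours of $u$). Equivalently, $$\sum_{u\in V(G)}\sum_{v,w\in N_G(u),\ v\neq w}|r^*(v)\cap r^*(w)|\ \geq\ \sum_{u\in V(G)}\sum_{v,w\in N_G(u),\ v\neq w}|r(v)\cap r(w)|$$ for every proper $k$-restraint $r$ on $G$.
   Context: A restraint $r$ on a graph $G$ assigns to each vertex $v$ a finite set $r(v)\subset\mathbb{N}$ of forbidden colours; a proper $x$-colouring $c$ of $G$ is permitted by $r$ if $c(v)\notin r(v)$ for all $v$, and $\pi_r(G,x)$ denotes the number of proper $x$-colourings permitted by $r$. If $G$ has $n$ vertices, a $k$-restraint is a restraint with $|r(v)|=k$ and $r(v)\subseteq\{1,2,\dots,kn\}$ for every vertex $v$. A restraint is proper if $r(u)\cap r(v)=\emptyset$ for every edge $uv$. $N_G(u)$ is the set of neighbours of $u$. $R_{\max}(G,k)$ is the set of $k$-restraints $r$ on $G$ such that for every $k$-restraint $r'$ on $G$, $\pi_r(G,x)\geq\pi_{r'}(G,x)$ for all sufficiently large $x$. -}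

module Defs where

open import Data.Nat using (ℕ; zero; suc; _+_; _*_; _≤_; _≥_; _≡ᵇ_; _<ᵇ_)
open import Data.Bool using (Bool; true; false; _∧_; _∨_; not; if_then_else_)
open import Data.Fin using (Fin; zero; suc; toℕ)
open import Data.Fin.Subset using (Subset; _∩_; ∣_∣)
open import Data.Vec using (lookup)
open import Data.Product using (Σ; ∃; _×_; _,_)
open import Relation.Binary.PropositionalEquality using (_≡_)

record Graph (n : ℕ) : Set where
  field
    adj    : Fin n → Fin n → Bool
    sym    : ∀ u v → adj u v ≡ adj v u
    irrefl : ∀ v → adj v v ≡ false
open Graph public

Σᶠ : ∀ {m} → (Fin m → ℕ) → ℕ
Σᶠ {zero}  f = 0
Σᶠ {suc m} f = f zero + Σᶠ (λ i → f (suc i))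

allᵇ : ∀ {m} → (Fin m → Bool) → Bool
allᵇ {zero}  p = true
allᵇ {suc m} p = p zero ∧ allᵇ (λ i → p (suc i))

anyᵇ : ∀ {m} → (Fin m → Bool) → Bool
anyᵇ {zero}  p = false
anyᵇ {suc m} p = p zero ∨ anyᵇ (λ i → p (suc i))

-- A restraint whose forbidden colours lie in {1,…,kn}: colour i+1 is encoded
-- by the element i : Fin (k * n).  (Colours are 1,2,3,…; colour c+1 is encoded by c.)
record Restraint (n k : ℕ) : Set where
  constructor restraint
  field
    forb : Fin n → Subset (k * n)
open Restraint public

IsKRestraint : ∀ {n} k → Restraint n k → Set
IsKRestraint k r = ∀ v → ∣ forb r v ∣ ≡ k

IsProperRestraint : ∀ {n k} → Graph n → Restraint n k → Set
IsProperRestraint G r = ∀ u v → adj G u v ≡ true → ∣ forb r u ∩ forb r v ∣ ≡ 0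

-- An x-colouring assigns to each vertex a colour in {1,…,x}, colour c+1 encoded by c : Fin x.
-- Proper: adjacent vertices get different colours.
properColᵇ : ∀ {n x} → Graph n → (Fin n → Fin x) → Bool
properColᵇ G c = allᵇ (λ u → allᵇ (λ v → not (adj G u v ∧ (toℕ (c u) ≡ᵇ toℕ (c v)))))

permittedᵇ : ∀ {n k x} → Restraint n k → (Fin n → Fin x) → Bool
permittedᵇ r c = allᵇ (λ v → not (anyᵇ (λ j → (toℕ j ≡ᵇ toℕ (c v)) ∧ lookup (forb r v) j)))

extend : ∀ {n x} → Fin x → (Fin n → Fin x) → Fin (suc n) → Fin x
extend a f zero    = a
extend a f (suc i) = f i

countFun : ∀ n x → ((Fin n → Fin x) → Bool) → ℕ
countFun zero    x P = if P (λ ()) then 1 else 0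
countFun (suc n) x P = Σᶠ (λ (a : Fin x) → countFun n x (λ f → P (extend a f)))

πr : ∀ {n k} → Graph n → Restraint n k → ℕ → ℕ
πr {n} G r x = countFun n x (λ c → properColᵇ G c ∧ permittedᵇ r c)

InRmax : ∀ {n} → Graph n → (k : ℕ) → Restraint n k → Set
InRmax {n} G k r =
  IsKRestraint k r ×
  (∀ (r' : Restraint n k) → IsKRestraint k r' →
     ∃ λ (N : ℕ) → ∀ x → x ≥ N → πr G r x ≥ πr G r' x)

-- Σ_{u} Σ_{unordered pairs {v,w} ⊆ N_G(u), v ≠ w} |r(v) ∩ r(w)|   (= - A₇''(G,r)).
-- Unordered pairs are enumerated as ordered pairs with toℕ v < toℕ w.
negA7'' : ∀ {n k} → Graph n → Restraint n k → ℕ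
negA7'' G r =
  Σᶠ (λ u → Σᶠ (λ v → Σᶠ (λ w →
    if adj G u v ∧ adj G u w ∧ (toℕ v <ᵇ toℕ w) then ∣ forb r v ∩ forb r w ∣ else 0)))

module Submission where

-- Count colourings with x = K + y colours, K = k n.  The K "low" colours are the
-- only ones a k-restraint can forbid; the y "high" colours are always permitted.  Splitting a
-- colouring into its low pattern p (low colour or "high" at each vertex) and its high part
-- gives π_r(G, K + y) = Σ_p [p proper and permitted] · H(high vertices of p), where H counts
-- proper y-colourings of the high vertices, so y^h ≥ H ≥ y^h − n² y^(h−1) for h high vertices.
-- Grouping patterns by their number j of low vertices expands π_r in powers of y: the terms
-- j = 0, 1 are the same for all k-restraints; the term j = 2 is a common value minus
-- Σ_{edges ab} |r(a) ∩ r(b)| · H(V ∖ {a, b}); for proper restraints the term j = 3 is a common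
-- value minus ≈ y^(n−3) (−A₇''); patterns with more low vertices contribute O(y^(n−j−1)).
-- (i) a clash on an edge makes r lose, for all large y, against an explicit proper k-restraint;
-- (ii) a proper k-restraint with smaller −A₇'' loses likewise.  Both contradict maximality.

open import Defs renaming (sym to gsym)
open import Data.Nat using (ℕ; zero; suc; _+_; _*_; _≤_; _≥_; _<_; _^_; _≡ᵇ_; _<ᵇ_; z≤n; s≤s; NonZero)
open import Data.Nat.Properties
open import Data.Nat.Tactic.RingSolver
open import Data.Bool using (Bool; true; false; _∧_; _∨_; not; if_then_else_)
open import Data.Bool.Properties using (∧-zeroʳ; ∧-identityʳ; ∧-assoc; ∧-comm; ∨-identityʳ)
open import Data.Fin using (Fin; zero; suc; toℕ; _↑ˡ_; _↑ʳ_; combine; remainder)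
open import Data.Fin.Properties using (toℕ<n; toℕ-↑ʳ; toℕ-↑ˡ; toℕ-injective; remQuot-combine)
open import Data.Fin.Subset using (Subset; _∩_; ∣_∣)
open import Data.Vec using ([]; _∷_; lookup; tabulate)
open import Data.Vec.Properties using (lookup∘tabulate)
open import Data.Product using (∃; _×_; _,_; proj₁; proj₂)
open import Relation.Binary.PropositionalEquality
open import Relation.Nullary using (¬_; yes; no)
open import Data.Empty using (⊥; ⊥-elim)
open import Function using (case_of_)
open ≡-Reasoning

⟦_⟧ : Bool → ℕ
⟦ b ⟧ = if b then 1 else 0

⟦∧⟧ : ∀ a b → ⟦ a ∧ b ⟧ ≡ ⟦ a ⟧ * ⟦ b ⟧
⟦∧⟧ true b = sym (+-identityʳ ⟦ b ⟧)
⟦∧⟧ false b = refl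

⟦≤1⟧ : ∀ b → ⟦ b ⟧ ≤ 1
⟦≤1⟧ true = s≤s z≤n
⟦≤1⟧ false = z≤n

⟦not⟧+ : ∀ b → ⟦ b ⟧ + ⟦ not b ⟧ ≡ 1
⟦not⟧+ true = refl
⟦not⟧+ false = refl

Π : ∀ {m} → (Fin m → ℕ) → ℕ
Π {zero} f = 1
Π {suc m} f = f zero * Π (λ i → f (suc i))

Σ-cong : ∀ {m} {f g : Fin m → ℕ} → (∀ i → f i ≡ g i) → Σᶠ f ≡ Σᶠ g
Σ-cong {zero} e = refl
Σ-cong {suc m} e = cong₂ _+_ (e zero) (Σ-cong (λ i → e (suc i)))

Π-cong : ∀ {m} {f g : Fin m → ℕ} → (∀ i → f i ≡ g i) → Π f ≡ Π g
Π-cong {zero} e = refl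
Π-cong {suc m} e = cong₂ _*_ (e zero) (Π-cong (λ i → e (suc i)))

Σ-+ : ∀ {m} (f g : Fin m → ℕ) → Σᶠ (λ i → f i + g i) ≡ Σᶠ f + Σᶠ g
Σ-+ {zero} f g = refl
Σ-+ {suc m} f g = trans (cong ((f zero + g zero) +_) (Σ-+ (λ i → f (suc i)) (λ i → g (suc i))))
  (interchange (f zero) (g zero) (Σᶠ (λ i → f (suc i))) (Σᶠ (λ i → g (suc i))))
  where
  interchange : ∀ a b c d → (a + b) + (c + d) ≡ (a + c) + (b + d)
  interchange = solve-∀

Σ-*ˡ : ∀ {m} c (f : Fin m → ℕ) → Σᶠ (λ i → c * f i) ≡ c * Σᶠ f
Σ-*ˡ {zero} c f = sym (*-zeroʳ c)
Σ-*ˡ {suc m} c f = trans (cong (c * f zero +_) (Σ-*ˡ c (λ i → f (suc i)))) (sym (*-distribˡ-+ c (f zero) _))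

Σ-*ʳ : ∀ {m} c (f : Fin m → ℕ) → Σᶠ (λ i → f i * c) ≡ Σᶠ f * c
Σ-*ʳ c f = trans (Σ-cong (λ i → *-comm (f i) c)) (trans (Σ-*ˡ c f) (*-comm c _))

Σ-mono : ∀ {m} {f g : Fin m → ℕ} → (∀ i → f i ≤ g i) → Σᶠ f ≤ Σᶠ g
Σ-mono {zero} e = z≤n
Σ-mono {suc m} e = +-mono-≤ (e zero) (Σ-mono (λ i → e (suc i)))

Σ-const : ∀ m c → Σᶠ {m} (λ _ → c) ≡ m * c
Σ-const zero c = refl
Σ-const (suc m) c = cong (c +_) (Σ-const m c)

Σ-zero : ∀ {m} {f : Fin m → ℕ} → (∀ i → f i ≡ 0) → Σᶠ f ≡ 0
Σ-zero {m} {f} e = trans (Σ-cong e) (trans (Σ-const m 0) (*-zeroʳ m))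

Σ-swap : ∀ {a b} (f : Fin a → Fin b → ℕ) → Σᶠ (λ i → Σᶠ (λ j → f i j)) ≡ Σᶠ (λ j → Σᶠ (λ i → f i j))
Σ-swap {zero} {b} f = sym (Σ-zero {b} (λ j → refl))
Σ-swap {suc a} {b} f = begin
  Σᶠ (λ j → f zero j) + Σᶠ (λ i → Σᶠ (λ j → f (suc i) j))
    ≡⟨ cong (Σᶠ (λ j → f zero j) +_) (Σ-swap (λ i j → f (suc i) j)) ⟩
  Σᶠ (λ j → f zero j) + Σᶠ (λ j → Σᶠ (λ i → f (suc i) j))
    ≡⟨ sym (Σ-+ (λ j → f zero j) _) ⟩
  Σᶠ (λ j → f zero j + Σᶠ (λ i → f (suc i) j)) ∎

Σ-split : ∀ a b (f : Fin (a + b) → ℕ) → Σᶠ f ≡ Σᶠ (λ i → f (i ↑ˡ b)) + Σᶠ (λ j → f (a ↑ʳ j))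
Σ-split zero b f = refl
Σ-split (suc a) b f = trans (cong (f zero +_) (Σ-split a b (λ i → f (suc i)))) (sym (+-assoc (f zero) _ _))

Σ-term : ∀ {m} (f : Fin m → ℕ) (a : Fin m) → f a ≤ Σᶠ f
Σ-term f zero = m≤m+n _ _
Σ-term f (suc a) = ≤-trans (Σ-term (λ i → f (suc i)) a) (m≤n+m _ (f zero))

Σ² : ∀ {m} → (Fin m → Fin m → ℕ) → ℕ
Σ² F = Σᶠ (λ α → Σᶠ (λ β → F α β))

Σ³ : ∀ {m} → (Fin m → Fin m → Fin m → ℕ) → ℕ
Σ³ F = Σᶠ (λ α → Σᶠ (λ β → Σᶠ (λ γ → F α β γ)))

Σ²-cong : ∀ {m} {F G : Fin m → Fin m → ℕ} → (∀ α β → F α β ≡ G α β) → Σ² F ≡ Σ² G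
Σ²-cong e = Σ-cong (λ α → Σ-cong (λ β → e α β))

Σ³-cong : ∀ {m} {F G : Fin m → Fin m → Fin m → ℕ} → (∀ α β γ → F α β γ ≡ G α β γ) → Σ³ F ≡ Σ³ G
Σ³-cong e = Σ-cong (λ α → Σ-cong (λ β → Σ-cong (λ γ → e α β γ)))

Σ³-mono : ∀ {m} {F G : Fin m → Fin m → Fin m → ℕ} → (∀ α β γ → F α β γ ≤ G α β γ) → Σ³ F ≤ Σ³ G
Σ³-mono e = Σ-mono (λ α → Σ-mono (λ β → Σ-mono (λ γ → e α β γ)))

Σ²-+ : ∀ {m} (F G : Fin m → Fin m → ℕ) → Σ² (λ α β → F α β + G α β) ≡ Σ² F + Σ² G
Σ²-+ F G = trans (Σ-cong (λ α → Σ-+ (F α) (G α))) (Σ-+ (λ α → Σᶠ (F α)) (λ α → Σᶠ (G α)))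

Σ³-+ : ∀ {m} (F G : Fin m → Fin m → Fin m → ℕ) → Σ³ (λ α β γ → F α β γ + G α β γ) ≡ Σ³ F + Σ³ G
Σ³-+ F G = trans (Σ-cong (λ α → trans (Σ-cong (λ β → Σ-+ (F α β) (G α β))) (Σ-+ (λ β → Σᶠ (F α β)) (λ β → Σᶠ (G α β)))))
   (Σ-+ (λ α → Σᶠ (λ β → Σᶠ (F α β))) (λ α → Σᶠ (λ β → Σᶠ (G α β))))

Σ²-*ˡ : ∀ {m} c (F : Fin m → Fin m → ℕ) → Σ² (λ α β → c * F α β) ≡ c * Σ² F
Σ²-*ˡ c F = trans (Σ-cong (λ α → Σ-*ˡ c (F α))) (Σ-*ˡ c (λ α → Σᶠ (F α)))

Σ³-*ˡ : ∀ {m} c (F : Fin m → Fin m → Fin m → ℕ) → Σ³ (λ α β γ → c * F α β γ) ≡ c * Σ³ F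
Σ³-*ˡ c F = trans (Σ-cong (λ α → trans (Σ-cong (λ β → Σ-*ˡ c (F α β))) (Σ-*ˡ c (λ β → Σᶠ (F α β)))))
   (Σ-*ˡ c (λ α → Σᶠ (λ β → Σᶠ (F α β))))

Σ-zero-inv : ∀ {m} (f : Fin m → ℕ) → Σᶠ f ≡ 0 → ∀ i → f i ≡ 0
Σ-zero-inv f e zero = m+n≡0⇒m≡0 (f zero) e
Σ-zero-inv f e (suc i) = Σ-zero-inv (λ j → f (suc j)) (m+n≡0⇒n≡0 (f zero) e) i

Σ-pos : ∀ {m} (f : Fin m → ℕ) → 0 < Σᶠ f → ∃ λ i → 0 < f i
Σ-pos {suc m} f lt with f zero in e
... | suc x = zero , subst (0 <_) (sym e) (s≤s z≤n)
... | zero = let (i , p) = Σ-pos (λ j → f (suc j)) lt in suc i , p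

eqF : ∀ {m} → Fin m → Fin m → Bool
eqF i j = toℕ i ≡ᵇ toℕ j

eqF-refl : ∀ {m} (i : Fin m) → eqF i i ≡ true
eqF-refl zero = refl
eqF-refl (suc i) = eqF-refl i

eqF-sym : ∀ {m} (i j : Fin m) → eqF i j ≡ eqF j i
eqF-sym zero zero = refl
eqF-sym zero (suc j) = refl
eqF-sym (suc i) zero = refl
eqF-sym (suc i) (suc j) = eqF-sym i j

eqF-true : ∀ {m} (i j : Fin m) → eqF i j ≡ true → i ≡ j
eqF-true zero zero e = refl
eqF-true zero (suc j) ()
eqF-true (suc i) zero ()
eqF-true (suc i) (suc j) e = cong suc (eqF-true i j e)

Σ-point : ∀ {m} (f : Fin m → ℕ) (a : Fin m) → Σᶠ (λ i → ⟦ eqF i a ⟧ * f i) ≡ f a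
Σ-point {suc m} f zero = trans (cong₂ _+_ (+-identityʳ (f zero)) (Σ-zero {m} {λ i → ⟦ eqF (suc i) (zero {m}) ⟧ * f (suc i)} (λ i → refl))) (+-identityʳ _)
Σ-point {suc m} f (suc a) = Σ-point (λ i → f (suc i)) a

Σ-indicator : ∀ {m} (a : Fin m) → Σᶠ (λ z → ⟦ eqF z a ⟧) ≡ 1
Σ-indicator a = trans (Σ-cong (λ z → sym (*-identityʳ ⟦ eqF z a ⟧))) (Σ-point (λ _ → 1) a)

ΣMaps : ∀ n A → ((Fin n → Fin A) → ℕ) → ℕ
ΣMaps zero A F = F (λ ())
ΣMaps (suc n) A F = Σᶠ (λ a → ΣMaps n A (λ f → F (extend a f)))

-- F respects pointwise equality of maps; needed since function extensionality is not available.
Extensional : ∀ {n A} → ((Fin n → Fin A) → ℕ) → Set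
Extensional {n} {A} F = ∀ (f g : Fin n → Fin A) → (∀ i → f i ≡ g i) → F f ≡ F g

countFun≡ΣMaps : ∀ n x P → countFun n x P ≡ ΣMaps n x (λ f → ⟦ P f ⟧)
countFun≡ΣMaps zero x P = refl
countFun≡ΣMaps (suc n) x P = Σ-cong (λ a → countFun≡ΣMaps n x (λ f → P (extend a f)))

ΣMaps-cong : ∀ n A {F G : (Fin n → Fin A) → ℕ} → (∀ f → F f ≡ G f) → ΣMaps n A F ≡ ΣMaps n A G
ΣMaps-cong zero A e = e _
ΣMaps-cong (suc n) A e = Σ-cong (λ a → ΣMaps-cong n A (λ f → e (extend a f)))

ΣMaps-mono : ∀ n A {F G : (Fin n → Fin A) → ℕ} → (∀ f → F f ≤ G f) → ΣMaps n A F ≤ ΣMaps n A G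
ΣMaps-mono zero A e = e _
ΣMaps-mono (suc n) A e = Σ-mono (λ a → ΣMaps-mono n A (λ f → e (extend a f)))

ΣMaps-+ : ∀ n A (F G : (Fin n → Fin A) → ℕ) → ΣMaps n A (λ f → F f + G f) ≡ ΣMaps n A F + ΣMaps n A G
ΣMaps-+ zero A F G = refl
ΣMaps-+ (suc n) A F G = trans (Σ-cong (λ a → ΣMaps-+ n A (λ f → F (extend a f)) (λ f → G (extend a f)))) (Σ-+ (λ a → ΣMaps n A (λ f → F (extend a f))) (λ a → ΣMaps n A (λ f → G (extend a f))))

ΣMaps-*ˡ : ∀ n A c (F : (Fin n → Fin A) → ℕ) → ΣMaps n A (λ f → c * F f) ≡ c * ΣMaps n A F
ΣMaps-*ˡ zero A c F = refl
ΣMaps-*ˡ (suc n) A c F = trans (Σ-cong (λ a → ΣMaps-*ˡ n A c (λ f → F (extend a f)))) (Σ-*ˡ c (λ a → ΣMaps n A (λ f → F (extend a f))))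

ΣMaps-Σ : ∀ n A {b} (F : (Fin n → Fin A) → Fin b → ℕ) → ΣMaps n A (λ f → Σᶠ (F f)) ≡ Σᶠ (λ j → ΣMaps n A (λ f → F f j))
ΣMaps-Σ zero A F = refl
ΣMaps-Σ (suc n) A F = trans (Σ-cong (λ a → ΣMaps-Σ n A (λ f → F (extend a f)))) (Σ-swap (λ a j → ΣMaps n A (λ f → F (extend a f) j)))

ΣMaps-zero : ∀ n A {F : (Fin n → Fin A) → ℕ} → (∀ f → F f ≡ 0) → ΣMaps n A F ≡ 0
ΣMaps-zero zero A e = e _
ΣMaps-zero (suc n) A e = Σ-zero (λ a → ΣMaps-zero n A (λ f → e (extend a f)))

extend-η : ∀ {n x} (f : Fin (suc n) → Fin x) → ∀ i → extend (f zero) (λ j → f (suc j)) i ≡ f i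
extend-η f zero = refl
extend-η f (suc i) = refl

Extensional-extend : ∀ {n A} (F : (Fin (suc n) → Fin A) → ℕ) → Extensional F → ∀ a → Extensional (λ f → F (extend a f))
Extensional-extend F r a f g e = r _ _ λ { zero → refl ; (suc i) → e i }

ΣMaps-term : ∀ n A (F : (Fin n → Fin A) → ℕ) → Extensional F → ∀ f → F f ≤ ΣMaps n A F
ΣMaps-term zero A F r f = ≤-reflexive (r _ _ (λ ()))
ΣMaps-term (suc n) A F r f = ≤-trans (≤-reflexive (sym (r _ _ (extend-η f))))
  (≤-trans (ΣMaps-term n A (λ g → F (extend (f zero) g)) (Extensional-extend F r (f zero)) (λ j → f (suc j)))
     (Σ-term (λ a → ΣMaps n A (λ g → F (extend a g))) (f zero)))

⟦allᵇ⟧ : ∀ {m} (p : Fin m → Bool) → ⟦ allᵇ p ⟧ ≡ Π (λ i → ⟦ p i ⟧)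
⟦allᵇ⟧ {zero} p = refl
⟦allᵇ⟧ {suc m} p = trans (⟦∧⟧ (p zero) _) (cong (⟦ p zero ⟧ *_) (⟦allᵇ⟧ (λ i → p (suc i))))

ΣMaps-prod : ∀ n A (w : Fin n → Fin A → ℕ) → ΣMaps n A (λ f → Π (λ z → w z (f z))) ≡ Π (λ z → Σᶠ (w z))
ΣMaps-prod zero A w = refl
ΣMaps-prod (suc n) A w = trans (Σ-cong (λ a → trans (ΣMaps-*ˡ n A (w zero a) _) (cong (w zero a *_) (ΣMaps-prod n A (λ z → w (suc z))))))
  (Σ-*ʳ _ (w zero))

Π-const : ∀ m c → Π {m} (λ _ → c) ≡ c ^ m
Π-const zero c = refl
Π-const (suc m) c = cong (c *_) (Π-const m c)

ΣMaps-const : ∀ n A c → ΣMaps n A (λ _ → c) ≡ A ^ n * c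
ΣMaps-const zero A c = sym (+-identityʳ c)
ΣMaps-const (suc n) A c = trans (Σ-cong {A} {λ a → ΣMaps n A (λ f → c)} {λ a → A ^ n * c} (λ a → ΣMaps-const n A c)) (trans (Σ-const A (A ^ n * c)) (sym (*-assoc A (A ^ n) c)))

Π-point : ∀ {m} (g : Fin m → ℕ) (u : Fin m) → Π g ≡ g u * Π (λ z → if eqF z u then 1 else g z)
Π-point {suc m} g zero = cong (g zero *_) (sym (+-identityʳ (Π (λ i → g (suc i)))))
Π-point {suc m} g (suc u) = begin
  g zero * Π (λ i → g (suc i)) ≡⟨ cong (g zero *_) (Π-point (λ i → g (suc i)) u) ⟩
  g zero * (g (suc u) * Π (λ i → if eqF i u then 1 else g (suc i))) ≡⟨ sym (*-assoc (g zero) _ _) ⟩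
  (g zero * g (suc u)) * Π (λ i → if eqF i u then 1 else g (suc i)) ≡⟨ cong (_* Π (λ i → if eqF i u then 1 else g (suc i))) (*-comm (g zero) _) ⟩
  (g (suc u) * g zero) * Π (λ i → if eqF i u then 1 else g (suc i)) ≡⟨ *-assoc (g (suc u)) _ _ ⟩
  g (suc u) * (g zero * Π (λ i → if eqF i u then 1 else g (suc i))) ∎

-- In Fin (suc K) the value zero stands for "high", suc α for the low colour α.
isLow : ∀ {m} → Fin (suc m) → Bool
isLow zero = false
isLow (suc _) = true

isZero : ∀ {m} → Fin (suc m) → Bool
isZero zero = true
isZero (suc _) = false

ExtensionalB : ∀ {n A} → ((Fin n → Fin A) → Bool) → Set
ExtensionalB {n} {A} P = ∀ (f g : Fin n → Fin A) → (∀ i → f i ≡ g i) → P f ≡ P g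

-- Colours of Fin (K + y) are the K low colours (those a restraint may forbid)
-- followed by y high ones.  A colouring c corresponds to a pair (p , h): p records the
-- low colour of every low vertex and "high" elsewhere, h the high colour of every high
-- vertex and, to make the correspondence bijective, the first high colour elsewhere.
module ColourSplit (K y' : ℕ) where
  y : ℕ
  y = suc y'

  mergeColour : Fin (suc K) → Fin y → Fin (K + y)
  mergeColour zero b = K ↑ʳ b
  mergeColour (suc α) b = α ↑ˡ y

  merge : ∀ {m} → (Fin m → Fin (suc K)) → (Fin m → Fin y) → Fin m → Fin (K + y)
  merge p h z = mergeColour (p z) (h z)

  compat : ∀ {m} → (Fin m → Fin (suc K)) → (Fin m → Fin y) → Bool
  compat p h = allᵇ (λ z → not (isLow (p z)) ∨ isZero (h z))

  ΣMaps-split : ∀ m (P : (Fin m → Fin (K + y)) → Bool) → ExtensionalB P →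
    ΣMaps m (K + y) (λ f → ⟦ P f ⟧) ≡ ΣMaps m (suc K) (λ p → ΣMaps m y (λ h → ⟦ compat p h ⟧ * ⟦ P (merge p h) ⟧))

  ExtensionalB-extend : ∀ {m} (P : (Fin (suc m) → Fin (K + y)) → Bool) → ExtensionalB P → ∀ a → ExtensionalB (λ f → P (extend a f))
  ExtensionalB-extend P rP a f g e = rP _ _ (λ { zero → refl ; (suc i) → e i })

  first-vertex-high : ∀ m (P : (Fin (suc m) → Fin (K + y)) → Bool) → ExtensionalB P → ∀ b →
    ΣMaps m (K + y) (λ f → ⟦ P (extend (K ↑ʳ b) f) ⟧) ≡
    ΣMaps m (suc K) (λ p → ΣMaps m y (λ h → ⟦ compat p h ⟧ * ⟦ P (merge (extend zero p) (extend b h)) ⟧))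
  first-vertex-high m P rP b = trans (ΣMaps-split m (λ f → P (extend (K ↑ʳ b) f)) (ExtensionalB-extend P rP (K ↑ʳ b)))
    (ΣMaps-cong m (suc K) (λ p → ΣMaps-cong m y (λ h → cong (λ t → ⟦ compat p h ⟧ * ⟦ t ⟧)
       (rP _ _ (λ { zero → refl ; (suc i) → refl })))))

  first-vertex-low : ∀ m (P : (Fin (suc m) → Fin (K + y)) → Bool) → ExtensionalB P → ∀ α →
    ΣMaps m (K + y) (λ f → ⟦ P (extend (α ↑ˡ y) f) ⟧) ≡
    ΣMaps m (suc K) (λ p → ΣMaps (suc m) y (λ h → ⟦ compat (extend (suc α) p) h ⟧ * ⟦ P (merge (extend (suc α) p) h) ⟧))
  first-vertex-low m P rP α = trans (ΣMaps-split m (λ f → P (extend (α ↑ˡ y) f)) (ExtensionalB-extend P rP (α ↑ˡ y)))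
    (ΣMaps-cong m (suc K) (λ p → sym (trans
       (cong (_+ Σᶠ (λ b → ΣMaps m y (λ h → ⟦ false ∧ compat p h ⟧ * ⟦ P (merge (extend (suc α) p) (extend (suc b) h)) ⟧)))
          (ΣMaps-cong m y (λ h → cong (λ t → ⟦ compat p h ⟧ * ⟦ t ⟧) (rP _ _ (λ { zero → refl ; (suc i) → refl })))))
       (trans (cong (ΣMaps m y (λ h → ⟦ compat p h ⟧ * ⟦ P (extend (α ↑ˡ y) (merge p h)) ⟧) +_)
                 (Σ-zero {y'} {λ b → ΣMaps m y (λ h → ⟦ false ∧ compat p h ⟧ * ⟦ P (merge (extend (suc α) p) (extend (suc b) h)) ⟧)}
                    (λ b → ΣMaps-zero m y (λ h → refl))))
          (+-identityʳ _)))))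

  ΣMaps-split zero P rP = trans (cong ⟦_⟧ (rP _ _ (λ ()))) (sym (+-identityʳ _))
  ΣMaps-split (suc m) P rP = begin
    Σᶠ (λ a → ΣMaps m (K + y) (λ f → ⟦ P (extend a f) ⟧))
      ≡⟨ Σ-split K y (λ a → ΣMaps m (K + y) (λ f → ⟦ P (extend a f) ⟧)) ⟩
    A1 + B1
      ≡⟨ +-comm A1 B1 ⟩
    B1 + A1
      ≡⟨ cong₂ _+_ (trans (Σ-cong (first-vertex-high m P rP)) (sym (ΣMaps-Σ m (suc K) (λ p b → ΣMaps m y (λ h → ⟦ compat p h ⟧ * ⟦ P (merge (extend zero p) (extend b h)) ⟧)))))
                   (Σ-cong (first-vertex-low m P rP)) ⟩
    ΣMaps m (suc K) (λ p → Σᶠ (λ b → ΣMaps m y (λ h → ⟦ compat p h ⟧ * ⟦ P (merge (extend zero p) (extend b h)) ⟧)))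
      + Σᶠ (λ α → ΣMaps m (suc K) (λ p → ΣMaps (suc m) y (λ h → ⟦ compat (extend (suc α) p) h ⟧ * ⟦ P (merge (extend (suc α) p) h) ⟧))) ∎
    where
      A1 : ℕ
      A1 = Σᶠ (λ α → ΣMaps m (K + y) (λ f → ⟦ P (extend (α ↑ˡ y) f) ⟧))
      B1 : ℕ
      B1 = Σᶠ (λ b → ΣMaps m (K + y) (λ f → ⟦ P (extend (K ↑ʳ b) f) ⟧))

allᵇ-cong : ∀ {m} {p q : Fin m → Bool} → (∀ i → p i ≡ q i) → allᵇ p ≡ allᵇ q
allᵇ-cong {zero} e = refl
allᵇ-cong {suc m} e = cong₂ _∧_ (e zero) (allᵇ-cong (λ i → e (suc i)))

∧-interchange : ∀ a b c d → (a ∧ b) ∧ (c ∧ d) ≡ (a ∧ c) ∧ (b ∧ d)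
∧-interchange true true c d = refl
∧-interchange true false c d = sym (∧-zeroʳ c)
∧-interchange false b c d = refl

allᵇ-∧ : ∀ {m} (p q : Fin m → Bool) → allᵇ (λ i → p i ∧ q i) ≡ allᵇ p ∧ allᵇ q
allᵇ-∧ {zero} p q = refl
allᵇ-∧ {suc m} p q = trans (cong ((p zero ∧ q zero) ∧_) (allᵇ-∧ (λ i → p (suc i)) (λ i → q (suc i))))
  (∧-interchange (p zero) (q zero) _ _)

≡ᵇ-+ : ∀ a x z → (a + x ≡ᵇ a + z) ≡ (x ≡ᵇ z)
≡ᵇ-+ zero x z = refl
≡ᵇ-+ (suc a) x z = ≡ᵇ-+ a x z

≡ᵇ-big : ∀ a x t → t < a → (a + x ≡ᵇ t) ≡ false
≡ᵇ-big (suc a) x zero lt = refl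
≡ᵇ-big (suc a) x (suc t) (s≤s lt) = ≡ᵇ-big a x t lt

≡ᵇ-sym : ∀ a b → (a ≡ᵇ b) ≡ (b ≡ᵇ a)
≡ᵇ-sym zero zero = refl
≡ᵇ-sym zero (suc b) = refl
≡ᵇ-sym (suc a) zero = refl
≡ᵇ-sym (suc a) (suc b) = ≡ᵇ-sym a b

anyᵇ-beyond : ∀ {m} (f : Fin m → Bool) t → m ≤ t → anyᵇ (λ j → (toℕ j ≡ᵇ t) ∧ f j) ≡ false
anyᵇ-beyond {zero} f t le = refl
anyᵇ-beyond {suc m} f (suc t) (s≤s le) = anyᵇ-beyond (λ j → f (suc j)) t le

anyᵇ-false : ∀ {m} {p : Fin m → Bool} → (∀ i → p i ≡ false) → anyᵇ p ≡ false
anyᵇ-false {zero} e = refl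
anyᵇ-false {suc m} e rewrite e zero = anyᵇ-false (λ i → e (suc i))

allᵇ-true : ∀ {m} {p : Fin m → Bool} → (∀ i → p i ≡ true) → allᵇ p ≡ true
allᵇ-true {zero} e = refl
allᵇ-true {suc m} e rewrite e zero = allᵇ-true (λ i → e (suc i))

anyᵇ-point : ∀ {m} (f : Fin m → Bool) (a : Fin m) → anyᵇ (λ j → (toℕ j ≡ᵇ toℕ a) ∧ f j) ≡ f a
anyᵇ-point {suc m} f zero = trans (cong (f zero ∨_) (anyᵇ-false {m} {λ i → (toℕ (suc i) ≡ᵇ 0) ∧ f (suc i)} (λ j → refl))) (∨-identityʳ (f zero))
anyᵇ-point {suc m} f (suc a) = anyᵇ-point (λ j → f (suc j)) a

adj-distinct : ∀ {n} (G : Graph n) {u v} → adj G u v ≡ true → ¬ u ≡ v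
adj-distinct G {u} uv refl with trans (sym uv) (irrefl G u)
... | ()

-- The high part contributes a factor Hcount that depends on
-- the set of low vertices only, not on the restraint.
module LowHigh {n} (G : Graph n) (k y' : ℕ) where
  K : ℕ
  K = k * n
  open ColourSplit K y' public

  Low : Set
  Low = Fin (suc K)

  lowMask : (Fin n → Low) → Fin n → Bool
  lowMask p z = isLow (p z)

  lowEq : Low → Low → Bool
  lowEq zero _ = false
  lowEq (suc α) zero = false
  lowEq (suc α) (suc β) = eqF α β

  permit : Subset K → Low → Bool
  permit s zero = true
  permit s (suc α) = not (lookup s α)

  properLow : (Fin n → Low) → Bool
  properLow p = allᵇ (λ u → allᵇ (λ v → not (adj G u v ∧ lowEq (p u) (p v))))

  permittedLow : Restraint n k → (Fin n → Low) → Bool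
  permittedLow r p = allᵇ (λ v → permit (forb r v) (p v))

  goodLow : Restraint n k → (Fin n → Low) → Bool
  goodLow r p = properLow p ∧ permittedLow r p

  properHigh : (Fin n → Bool) → (Fin n → Fin y) → Bool
  properHigh m h = allᵇ (λ u → allᵇ (λ v → not (not (m u) ∧ (not (m v) ∧ (adj G u v ∧ eqF (h u) (h v))))))

  compatHigh : (Fin n → Bool) → (Fin n → Fin y) → Bool
  compatHigh m h = allᵇ (λ z → not (m z) ∨ isZero (h z))

  -- The number of proper y-colourings of the subgraph induced on the high vertices.
  Hcount : (Fin n → Bool) → ℕ
  Hcount m = ΣMaps n y (λ h → ⟦ compatHigh m h ⟧ * ⟦ properHigh m h ⟧)

  properPermitted : Restraint n k → (Fin n → Fin (K + y)) → Bool
  properPermitted r c = properColᵇ G c ∧ permittedᵇ r c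

  merge-eq : ∀ a a' b b' → (toℕ (mergeColour a b) ≡ᵇ toℕ (mergeColour a' b')) ≡
     (lowEq a a' ∨ (not (isLow a) ∧ (not (isLow a') ∧ eqF b b')))
  merge-eq zero zero b b' rewrite toℕ-↑ʳ K b | toℕ-↑ʳ K b' = ≡ᵇ-+ K (toℕ b) (toℕ b')
  merge-eq zero (suc α') b b' rewrite toℕ-↑ʳ K b | toℕ-↑ˡ α' y = ≡ᵇ-big K (toℕ b) (toℕ α') (toℕ<n α')
  merge-eq (suc α) zero b b' rewrite toℕ-↑ʳ K b' | toℕ-↑ˡ α y =
    trans (≡ᵇ-sym (toℕ α) (K + toℕ b')) (≡ᵇ-big K (toℕ b') (toℕ α) (toℕ<n α))
  merge-eq (suc α) (suc α') b b' rewrite toℕ-↑ˡ α y | toℕ-↑ˡ α' y = sym (∨-f (eqF α α'))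
    where ∨-f : ∀ b → (b ∨ false) ≡ b
          ∨-f true = refl
          ∨-f false = refl

  edge-term-split : ∀ (e : Bool) a a' b b' →
    not (e ∧ (toℕ (mergeColour a b) ≡ᵇ toℕ (mergeColour a' b'))) ≡
    (not (e ∧ lowEq a a') ∧ not (not (isLow a) ∧ (not (isLow a') ∧ (e ∧ eqF b b'))))
  edge-term-split e zero zero b b' rewrite merge-eq zero zero b b' | ∧-zeroʳ e = refl
  edge-term-split e zero (suc α') b b' rewrite merge-eq zero (suc α') b b' | ∧-zeroʳ e = refl
  edge-term-split e (suc α) zero b b' rewrite merge-eq (suc α) zero b b' | ∧-zeroʳ e = refl
  edge-term-split e (suc α) (suc α') b b' rewrite toℕ-↑ˡ α y | toℕ-↑ˡ α' y = sym (∧-identityʳ _)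

  permit-split : ∀ (s : Subset K) a b → not (anyᵇ (λ j → (toℕ j ≡ᵇ toℕ (mergeColour a b)) ∧ lookup s j)) ≡ permit s a
  permit-split s zero b rewrite toℕ-↑ʳ K b = cong not (anyᵇ-beyond (lookup s) (K + toℕ b) (m≤m+n K _))
  permit-split s (suc α) b rewrite toℕ-↑ˡ α y = cong not (anyᵇ-point (lookup s) α)

  properPermitted-split : ∀ r p h → properPermitted r (merge p h) ≡ goodLow r p ∧ properHigh (lowMask p) h
  properPermitted-split r p h = begin
    properColᵇ G (merge p h) ∧ permittedᵇ r (merge p h)
      ≡⟨ cong₂ _∧_ (trans (allᵇ-cong (λ u → trans (allᵇ-cong (λ v → edge-term-split (adj G u v) (p u) (p v) (h u) (h v)))
                                               (allᵇ-∧ (LT u) (HT u))))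
                          (allᵇ-∧ (λ u → allᵇ (LT u)) (λ u → allᵇ (HT u))))
                   (allᵇ-cong (λ v → permit-split (forb r v) (p v) (h v))) ⟩
    (properLow p ∧ properHigh (lowMask p) h) ∧ permittedLow r p
      ≡⟨ ∧-assoc (properLow p) _ _ ⟩
    properLow p ∧ (properHigh (lowMask p) h ∧ permittedLow r p)
      ≡⟨ cong (properLow p ∧_) (∧-comm (properHigh (lowMask p) h) _) ⟩
    properLow p ∧ (permittedLow r p ∧ properHigh (lowMask p) h)
      ≡⟨ sym (∧-assoc (properLow p) _ _) ⟩
    goodLow r p ∧ properHigh (lowMask p) h ∎
    where
      LT : Fin n → Fin n → Bool
      LT u v = not (adj G u v ∧ lowEq (p u) (p v))
      HT : Fin n → Fin n → Bool
      HT u v = not (not (lowMask p u) ∧ (not (lowMask p v) ∧ (adj G u v ∧ eqF (h u) (h v))))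

  properPermitted-ext : ∀ r → ExtensionalB (properPermitted r)
  properPermitted-ext r f g e = cong₂ _∧_
    (allᵇ-cong (λ u → allᵇ-cong (λ v → cong₂ (λ a b → not (adj G u v ∧ (toℕ a ≡ᵇ toℕ b))) (e u) (e v))))
    (allᵇ-cong (λ v → cong (λ a → not (anyᵇ (λ j → (toℕ j ≡ᵇ toℕ a) ∧ lookup (forb r v) j))) (e v)))

  swap3 : ∀ a b c → a * (b * c) ≡ b * (a * c)
  swap3 a b c = trans (sym (*-assoc a b c)) (trans (cong (_* c) (*-comm a b)) (*-assoc b a c))

  π-as-lowSum : ∀ r → πr G r (K + y) ≡ ΣMaps n (suc K) (λ p → ⟦ goodLow r p ⟧ * Hcount (lowMask p))
  π-as-lowSum r = begin
    countFun n (K + y) (properPermitted r) ≡⟨ countFun≡ΣMaps n (K + y) (properPermitted r) ⟩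
    ΣMaps n (K + y) (λ f → ⟦ properPermitted r f ⟧) ≡⟨ ΣMaps-split n (properPermitted r) (properPermitted-ext r) ⟩
    ΣMaps n (suc K) (λ p → ΣMaps n y (λ h → ⟦ compat p h ⟧ * ⟦ properPermitted r (merge p h) ⟧))
      ≡⟨ ΣMaps-cong n (suc K) (λ p → trans (ΣMaps-cong n y (λ h →
            trans (cong (λ t → ⟦ compat p h ⟧ * ⟦ t ⟧) (properPermitted-split r p h))
             (trans (cong (⟦ compat p h ⟧ *_) (⟦∧⟧ (goodLow r p) (properHigh (lowMask p) h)))
               (swap3 ⟦ compat p h ⟧ ⟦ goodLow r p ⟧ ⟦ properHigh (lowMask p) h ⟧))))
            (ΣMaps-*ˡ n y ⟦ goodLow r p ⟧ (λ h → ⟦ compatHigh (lowMask p) h ⟧ * ⟦ properHigh (lowMask p) h ⟧))) ⟩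
    ΣMaps n (suc K) (λ p → ⟦ goodLow r p ⟧ * Hcount (lowMask p)) ∎

  Hcount-cong : ∀ {m m' : Fin n → Bool} → (∀ z → m z ≡ m' z) → Hcount m ≡ Hcount m'
  Hcount-cong {m} {m'} e = ΣMaps-cong n y (λ h → cong₂ (λ a b → ⟦ a ⟧ * ⟦ b ⟧)
    (allᵇ-cong (λ z → cong (λ t → not t ∨ isZero (h z)) (e z)))
    (allᵇ-cong (λ u → allᵇ-cong (λ v → cong₂ (λ a b → not (not a ∧ (not b ∧ (adj G u v ∧ eqF (h u) (h v))))) (e u) (e v)))))

  goodLow-cong : ∀ r {p q : Fin n → Low} → (∀ z → p z ≡ q z) → goodLow r p ≡ goodLow r q
  goodLow-cong r e = cong₂ _∧_
    (allᵇ-cong (λ u → allᵇ-cong (λ v → cong₂ (λ a b → not (adj G u v ∧ lowEq a b)) (e u) (e v))))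
    (allᵇ-cong (λ v → cong (permit (forb r v)) (e v)))

  lowWeight : Restraint n k → (Fin n → Low) → ℕ
  lowWeight r p = ⟦ goodLow r p ⟧ * Hcount (lowMask p)

  lowWeight-ext : ∀ r → Extensional (lowWeight r)
  lowWeight-ext r p q e = cong₂ _*_ (cong ⟦_⟧ (goodLow-cong r e)) (Hcount-cong (λ z → cong isLow (e z)))

allᵇ-wit : ∀ {m} (p : Fin m → Bool) → allᵇ p ≡ false → ∃ λ i → p i ≡ false
allᵇ-wit {suc m} p e with p zero in eq
... | false = zero , eq
... | true = let (i , q) = allᵇ-wit (λ i → p (suc i)) e in suc i , q

Π-* : ∀ {m} (f g : Fin m → ℕ) → Π (λ z → f z * g z) ≡ Π f * Π g
Π-* {zero} f g = refl
Π-* {suc m} f g = trans (cong ((f zero * g zero) *_) (Π-* (λ z → f (suc z)) (λ z → g (suc z))))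
  (interchange (f zero) (g zero) _ _)
  where
  interchange : ∀ a b c d → (a * b) * (c * d) ≡ (a * c) * (b * d)
  interchange = solve-∀

Π-single : ∀ {m} (g : Fin m → ℕ) (u : Fin m) → Π (λ z → if eqF z u then g z else 1) ≡ g u
Π-single {m} g u = begin
  Π F ≡⟨ Π-point F u ⟩
  F u * Π (λ z → if eqF z u then 1 else F z) ≡⟨ cong₂ _*_ (cong (λ t → if t then g u else 1) (eqF-refl u))
                                               (trans (Π-cong one) (Π-const m 1)) ⟩
  g u * 1 ^ m ≡⟨ cong (g u *_) (^-zeroˡ m) ⟩
  g u * 1 ≡⟨ *-identityʳ (g u) ⟩
  g u ∎
  where
  F : Fin m → ℕ
  F z = if eqF z u then g z else 1
  one : ∀ z → (if eqF z u then 1 else F z) ≡ 1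
  one z with eqF z u
  ... | true = refl
  ... | false = refl

module HighCount {n} (G : Graph n) (k y' : ℕ) where
  open LowHigh G k y'

  nHigh : (Fin n → Bool) → ℕ
  nHigh m = Σᶠ (λ z → ⟦ not (m z) ⟧)

  nLow+nHigh : ∀ m → Σᶠ (λ z → ⟦ m z ⟧) + nHigh m ≡ n
  nLow+nHigh m = trans (sym (Σ-+ (λ z → ⟦ m z ⟧) (λ z → ⟦ not (m z) ⟧)))
    (trans (Σ-cong (λ z → ⟦not⟧+ (m z))) (trans (Σ-const n 1) (*-identityʳ n)))

  V : (Fin n → Bool) → Fin n → ℕ
  V m z = if m z then 1 else y

  ΠV : ∀ {j} (m : Fin j → Bool) → Π (λ z → if m z then 1 else y) ≡ y ^ Σᶠ (λ z → ⟦ not (m z) ⟧)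
  ΠV {zero} m = refl
  ΠV {suc j} m with m zero
  ... | true = trans (+-identityʳ _) (ΠV (λ z → m (suc z)))
  ... | false = cong (y *_) (ΠV (λ z → m (suc z)))

  colSum : ∀ b → Σᶠ {y} (λ c → ⟦ not b ∨ isZero c ⟧) ≡ (if b then 1 else y)
  colSum false = trans (Σ-const y 1) (*-identityʳ y)
  colSum true = trans (cong (1 +_) (Σ-zero {y'} {λ c → ⟦ isZero (suc c) ⟧} (λ c → refl))) refl

  ⟦compat⟧ : ∀ m h → ⟦ compatHigh m h ⟧ ≡ Π (λ z → ⟦ not (m z) ∨ isZero (h z) ⟧)
  ⟦compat⟧ m h = ⟦allᵇ⟧ (λ z → not (m z) ∨ isZero (h z))

  compatCount : ∀ m → ΣMaps n y (λ h → ⟦ compatHigh m h ⟧) ≡ y ^ nHigh m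
  compatCount m = begin
    ΣMaps n y (λ h → ⟦ compatHigh m h ⟧) ≡⟨ ΣMaps-cong n y (⟦compat⟧ m) ⟩
    ΣMaps n y (λ h → Π (λ z → ⟦ not (m z) ∨ isZero (h z) ⟧)) ≡⟨ ΣMaps-prod n y (λ z c → ⟦ not (m z) ∨ isZero c ⟧) ⟩
    Π (λ z → Σᶠ {y} (λ c → ⟦ not (m z) ∨ isZero c ⟧)) ≡⟨ Π-cong {n} {λ z → Σᶠ {y} (λ c → ⟦ not (m z) ∨ isZero c ⟧)} (λ z → colSum (m z)) ⟩
    Π (λ z → if m z then 1 else y) ≡⟨ ΠV m ⟩
    y ^ nHigh m ∎

  a*b≤a : ∀ a b → ⟦ b ⟧ ≤ 1 → a * ⟦ b ⟧ ≤ a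
  a*b≤a a true _ = ≤-reflexive (*-identityʳ a)
  a*b≤a a false _ = ≤-trans (≤-reflexive (*-zeroʳ a)) z≤n

  Hcount-upper : ∀ m → Hcount m ≤ y ^ nHigh m
  Hcount-upper m = ≤-trans (ΣMaps-mono n y (λ h → a*b≤a ⟦ compatHigh m h ⟧ (properHigh m h) (⟦≤1⟧ _))) (≤-reflexive (compatCount m))

  bad : (Fin n → Bool) → Fin n → Fin n → (Fin n → Fin y) → Bool
  bad m u v h = not (m u) ∧ (not (m v) ∧ (adj G u v ∧ eqF (h u) (h v)))

  -- Union bound: a normalised h is either proper or has a bad edge.
  properHigh-union : ∀ m h → ⟦ compatHigh m h ⟧ ≤ ⟦ compatHigh m h ⟧ * ⟦ properHigh m h ⟧ + Σᶠ (λ u → Σᶠ (λ v → ⟦ compatHigh m h ⟧ * ⟦ bad m u v h ⟧))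
  properHigh-union m h with properHigh m h in eq
  ... | true = ≤-trans (≤-reflexive (sym (*-identityʳ _))) (m≤m+n _ _)
  ... | false with allᵇ-wit _ eq
  ... | (u , e1) with allᵇ-wit _ e1
  ... | (v , e2) = ≤-trans (≤-reflexive (sym (*-identityʳ _)))
        (≤-trans (≤-trans (≤-reflexive (cong (λ t → ⟦ compatHigh m h ⟧ * ⟦ t ⟧) (sym (notfalse e2))))
            (≤-trans (Σ-term (λ v → ⟦ compatHigh m h ⟧ * ⟦ bad m u v h ⟧) v)
                     (Σ-term (λ u → Σᶠ (λ v → ⟦ compatHigh m h ⟧ * ⟦ bad m u v h ⟧)) u)))
          (m≤n+m _ _))
    where notfalse : ∀ {b} → not b ≡ false → b ≡ true
          notfalse {true} _ = refl

  -- Per-vertex weights counting normalised maps that give u and v a common colour b.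
  W : (Fin n → Bool) → Fin n → Fin n → Fin n → ℕ
  W m u v z = if eqF z u then 1 else (if eqF z v then 1 else V m z)

  wb : (Fin n → Bool) → Fin n → Fin n → Fin y → Fin n → Fin y → ℕ
  wb m u v b z c = ⟦ not (m z) ∨ isZero c ⟧ * ((if eqF z u then ⟦ eqF b c ⟧ else 1) * (if eqF z v then ⟦ eqF b c ⟧ else 1))

  sumEq1 : ∀ (b : Fin y) → Σᶠ {y} (λ c → ⟦ eqF b c ⟧) ≡ 1
  sumEq1 b = trans (Σ-cong (λ c → cong ⟦_⟧ (eqF-sym b c))) (Σ-indicator b)

  wbSum' : ∀ m u v → m u ≡ false → m v ≡ false → (u ≡ v → ⊥) → ∀ b z b1 b2 → eqF z u ≡ b1 → eqF z v ≡ b2 →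
    Σᶠ (wb m u v b z) ≡ (if b1 then 1 else (if b2 then 1 else V m z))
  wbSum' m u v mu mv uv b z true true e1 e2 = ⊥-elim (uv (trans (sym (eqF-true z u e1)) (eqF-true z v e2)))
  wbSum' m u v mu mv uv b z true false e1 e2 = trans (Σ-cong {y} {wb m u v b z} {λ c → ⟦ eqF b c ⟧} pt) (sumEq1 b)
    where
    mz : m z ≡ false
    mz = trans (cong m (eqF-true z u e1)) mu
    pt : ∀ c → wb m u v b z c ≡ ⟦ eqF b c ⟧
    pt c rewrite e1 | e2 | mz = trans (+-identityʳ _) (*-identityʳ _)
  wbSum' m u v mu mv uv b z false true e1 e2 = trans (Σ-cong {y} {wb m u v b z} {λ c → ⟦ eqF b c ⟧} pt) (sumEq1 b)
    where
    mz : m z ≡ false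
    mz = trans (cong m (eqF-true z v e2)) mv
    pt : ∀ c → wb m u v b z c ≡ ⟦ eqF b c ⟧
    pt c rewrite e1 | e2 | mz = trans (+-identityʳ _) (+-identityʳ _)
  wbSum' m u v mu mv uv b z false false e1 e2 = trans (Σ-cong {y} {wb m u v b z} {λ c → ⟦ not (m z) ∨ isZero c ⟧} pt) (colSum (m z))
    where
    pt : ∀ c → wb m u v b z c ≡ ⟦ not (m z) ∨ isZero c ⟧
    pt c rewrite e1 | e2 = *-identityʳ _

  wbSum : ∀ m u v → m u ≡ false → m v ≡ false → (u ≡ v → ⊥) → ∀ b z → Σᶠ (wb m u v b z) ≡ W m u v z
  wbSum m u v mu mv uv b z = wbSum' m u v mu mv uv b z _ _ refl refl

  ΠV-W : ∀ m u v → m u ≡ false → m v ≡ false → (u ≡ v → ⊥) → Π (V m) ≡ y * (y * Π (W m u v))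
  ΠV-W m u v mu mv uv = begin
    Π (V m) ≡⟨ Π-point (V m) u ⟩
    V m u * Π V1 ≡⟨ cong₂ _*_ (cong (λ t → if t then 1 else y) mu) (Π-point V1 v) ⟩
    y * (V1 v * Π (λ z → if eqF z v then 1 else V1 z)) ≡⟨ cong (λ t → y * (t * Π (λ z → if eqF z v then 1 else V1 z))) v1v ⟩
    y * (y * Π (λ z → if eqF z v then 1 else V1 z)) ≡⟨ cong (λ t → y * (y * t)) (Π-cong pt) ⟩
    y * (y * Π (W m u v)) ∎
    where
    V1 : Fin n → ℕ
    V1 z = if eqF z u then 1 else V m z
    v1v : V1 v ≡ y
    v1v with eqF v u in e
    ... | true = ⊥-elim (uv (sym (eqF-true v u e)))
    ... | false = cong (λ t → if t then 1 else y) mv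
    pt : ∀ z → (if eqF z v then 1 else V1 z) ≡ W m u v z
    pt z with eqF z u | eqF z v
    ... | true | true = refl
    ... | true | false = refl
    ... | false | true = refl
    ... | false | false = refl

  pair-coincidences : ∀ m u v → m u ≡ false → m v ≡ false → (u ≡ v → ⊥) →
    y * ΣMaps n y (λ h → ⟦ compatHigh m h ⟧ * ⟦ eqF (h u) (h v) ⟧) ≡ y ^ nHigh m
  pair-coincidences m u v mu mv uv = begin
    y * ΣMaps n y (λ h → ⟦ compatHigh m h ⟧ * ⟦ eqF (h u) (h v) ⟧)
      ≡⟨ cong (y *_) (ΣMaps-cong n y pw) ⟩
    y * ΣMaps n y (λ h → Σᶠ (λ b → Π (λ z → wb m u v b z (h z))))
      ≡⟨ cong (y *_) (ΣMaps-Σ n y (λ h b → Π (λ z → wb m u v b z (h z)))) ⟩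
    y * Σᶠ (λ b → ΣMaps n y (λ h → Π (λ z → wb m u v b z (h z))))
      ≡⟨ cong (y *_) (Σ-cong (λ b → trans (ΣMaps-prod n y (wb m u v b)) (Π-cong (wbSum m u v mu mv uv b)))) ⟩
    y * Σᶠ {y} (λ b → Π (W m u v))
      ≡⟨ cong (y *_) (Σ-const y (Π (W m u v))) ⟩
    y * (y * Π (W m u v)) ≡⟨ sym (ΠV-W m u v mu mv uv) ⟩
    Π (V m) ≡⟨ ΠV m ⟩
    y ^ nHigh m ∎
    where
    pw : ∀ h → ⟦ compatHigh m h ⟧ * ⟦ eqF (h u) (h v) ⟧ ≡ Σᶠ (λ b → Π (λ z → wb m u v b z (h z)))
    pw h = sym (begin
      Σᶠ (λ b → Π (λ z → wb m u v b z (h z)))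
        ≡⟨ Σ-cong (λ b → trans (Π-* (λ z → ⟦ not (m z) ∨ isZero (h z) ⟧) (λ z → (if eqF z u then ⟦ eqF b (h z) ⟧ else 1) * (if eqF z v then ⟦ eqF b (h z) ⟧ else 1)))
                  (cong₂ _*_ (sym (⟦compat⟧ m h))
                     (trans (Π-* (λ z → if eqF z u then ⟦ eqF b (h z) ⟧ else 1) (λ z → if eqF z v then ⟦ eqF b (h z) ⟧ else 1))
                        (cong₂ _*_ (Π-single (λ z → ⟦ eqF b (h z) ⟧) u) (Π-single (λ z → ⟦ eqF b (h z) ⟧) v))))) ⟩
      Σᶠ (λ b → ⟦ compatHigh m h ⟧ * (⟦ eqF b (h u) ⟧ * ⟦ eqF b (h v) ⟧))
        ≡⟨ Σ-*ˡ ⟦ compatHigh m h ⟧ (λ b → ⟦ eqF b (h u) ⟧ * ⟦ eqF b (h v) ⟧) ⟩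
      ⟦ compatHigh m h ⟧ * Σᶠ (λ b → ⟦ eqF b (h u) ⟧ * ⟦ eqF b (h v) ⟧)
        ≡⟨ cong (⟦ compatHigh m h ⟧ *_) (Σ-point (λ b → ⟦ eqF b (h v) ⟧) (h u)) ⟩
      ⟦ compatHigh m h ⟧ * ⟦ eqF (h u) (h v) ⟧ ∎)

  clash-count′ : ∀ m u v b1 b2 b3 → m u ≡ b1 → m v ≡ b2 → adj G u v ≡ b3 →
    y * ΣMaps n y (λ h → ⟦ compatHigh m h ⟧ * ⟦ bad m u v h ⟧) ≤ y ^ nHigh m
  clash-count′ m u v false false true e1 e2 e3 = ≤-reflexive (trans (cong (y *_) (ΣMaps-cong n y pw)) (pair-coincidences m u v e1 e2 (adj-distinct G e3)))
    where
    pw : ∀ h → ⟦ compatHigh m h ⟧ * ⟦ bad m u v h ⟧ ≡ ⟦ compatHigh m h ⟧ * ⟦ eqF (h u) (h v) ⟧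
    pw h rewrite e1 | e2 | e3 = refl
  clash-count′ m u v true b2 b3 e1 e2 e3 = ≤-trans (≤-reflexive (trans (cong (y *_) (ΣMaps-zero n y pw)) (*-zeroʳ y))) z≤n
    where
    pw : ∀ h → ⟦ compatHigh m h ⟧ * ⟦ bad m u v h ⟧ ≡ 0
    pw h rewrite e1 = *-zeroʳ ⟦ compatHigh m h ⟧
  clash-count′ m u v false true b3 e1 e2 e3 = ≤-trans (≤-reflexive (trans (cong (y *_) (ΣMaps-zero n y pw)) (*-zeroʳ y))) z≤n
    where
    pw : ∀ h → ⟦ compatHigh m h ⟧ * ⟦ bad m u v h ⟧ ≡ 0
    pw h rewrite e1 | e2 = *-zeroʳ ⟦ compatHigh m h ⟧
  clash-count′ m u v false false false e1 e2 e3 = ≤-trans (≤-reflexive (trans (cong (y *_) (ΣMaps-zero n y pw)) (*-zeroʳ y))) z≤n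
    where
    pw : ∀ h → ⟦ compatHigh m h ⟧ * ⟦ bad m u v h ⟧ ≡ 0
    pw h rewrite e1 | e2 | e3 = *-zeroʳ ⟦ compatHigh m h ⟧

  clash-count : ∀ m u v → y * ΣMaps n y (λ h → ⟦ compatHigh m h ⟧ * ⟦ bad m u v h ⟧) ≤ y ^ nHigh m
  clash-count m u v = clash-count′ m u v _ _ _ refl refl refl

  Hcount-lower : ∀ m → y ^ suc (nHigh m) ≤ y * Hcount m + n * (n * y ^ nHigh m)
  Hcount-lower m =
    ≤-trans (≤-reflexive (cong (y *_) (sym (compatCount m))))
    (≤-trans (*-monoʳ-≤ y (ΣMaps-mono n y (properHigh-union m)))
    (≤-trans (≤-reflexive e1)
    (+-monoʳ-≤ (y * Hcount m) (≤-trans (Σ-mono (λ u → Σ-mono (λ v → clash-count m u v)))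
       (≤-reflexive (trans (Σ-cong {n} {λ u → Σᶠ {n} (λ v → y ^ nHigh m)} (λ u → Σ-const n (y ^ nHigh m))) (Σ-const n (n * y ^ nHigh m))))))))
    where
    X : Fin n → Fin n → ℕ
    X u v = ΣMaps n y (λ h → ⟦ compatHigh m h ⟧ * ⟦ bad m u v h ⟧)
    e1 : y * ΣMaps n y (λ h → ⟦ compatHigh m h ⟧ * ⟦ properHigh m h ⟧ + Σᶠ (λ u → Σᶠ (λ v → ⟦ compatHigh m h ⟧ * ⟦ bad m u v h ⟧)))
         ≡ y * Hcount m + Σᶠ (λ u → Σᶠ (λ v → y * X u v))
    e1 = begin
      y * ΣMaps n y (λ h → ⟦ compatHigh m h ⟧ * ⟦ properHigh m h ⟧ + Σᶠ (λ u → Σᶠ (λ v → ⟦ compatHigh m h ⟧ * ⟦ bad m u v h ⟧)))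
        ≡⟨ cong (y *_) (trans (ΣMaps-+ n y (λ h → ⟦ compatHigh m h ⟧ * ⟦ properHigh m h ⟧) (λ h → Σᶠ (λ u → Σᶠ (λ v → ⟦ compatHigh m h ⟧ * ⟦ bad m u v h ⟧))))
             (cong (Hcount m +_) (trans (ΣMaps-Σ n y (λ h u → Σᶠ (λ v → ⟦ compatHigh m h ⟧ * ⟦ bad m u v h ⟧)))
               (Σ-cong (λ u → ΣMaps-Σ n y (λ h v → ⟦ compatHigh m h ⟧ * ⟦ bad m u v h ⟧)))))) ⟩
      y * (Hcount m + Σᶠ (λ u → Σᶠ (λ v → X u v)))
        ≡⟨ *-distribˡ-+ y (Hcount m) _ ⟩
      y * Hcount m + y * Σᶠ (λ u → Σᶠ (λ v → X u v))
        ≡⟨ cong (y * Hcount m +_) (trans (sym (Σ-*ˡ y (λ u → Σᶠ (λ v → X u v)))) (Σ-cong (λ u → sym (Σ-*ˡ y (λ v → X u v))))) ⟩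
      y * Hcount m + Σᶠ (λ u → Σᶠ (λ v → y * X u v)) ∎

-- The strict order of vertices; unordered pairs and triples are enumerated as increasing ones.
ltF : ∀ {m} → Fin m → Fin m → Bool
ltF a b = toℕ a <ᵇ toℕ b

tri2 : ∀ a b → ¬ a ≡ b → ⟦ a <ᵇ b ⟧ + ⟦ b <ᵇ a ⟧ ≡ 1
tri2 zero zero ne = ⊥-elim (ne refl)
tri2 zero (suc b) ne = refl
tri2 (suc a) zero ne = refl
tri2 (suc a) (suc b) ne = tri2 a b (λ e → ne (cong suc e))

ltF-total : ∀ {n} (u v : Fin n) → ¬ u ≡ v → ltF u v ≡ false → ltF v u ≡ true
ltF-total u v u≢v uv with tri2 (toℕ u) (toℕ v) (λ e → u≢v (toℕ-injective e))
... | t rewrite uv = ⟦⟧≡1 t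
  where
  ⟦⟧≡1 : ∀ {b} → ⟦ b ⟧ ≡ 1 → b ≡ true
  ⟦⟧≡1 {true} _ = refl

module FewLow (K : ℕ) where
  L : Set
  L = Fin (suc K)

  nLow : ∀ {m} → (Fin m → L) → ℕ
  nLow p = Σᶠ (λ z → ⟦ isLow (p z) ⟧)

  δ1 : ∀ {m} → Fin m → Fin K → Fin m → L
  δ1 a α z = if eqF z a then suc α else zero

  δ2 : ∀ {m} → Fin m → Fin K → Fin m → Fin K → Fin m → L
  δ2 a α b β z = if eqF z a then suc α else (if eqF z b then suc β else zero)

  δ3 : ∀ {m} → Fin m → Fin K → Fin m → Fin K → Fin m → Fin K → Fin m → L
  δ3 a α b β c γ z = if eqF z a then suc α else (if eqF z b then suc β else (if eqF z c then suc γ else zero))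

  ΣLow₀ : ∀ m (F : (Fin m → L) → ℕ) → Extensional F → ΣMaps m (suc K) (λ p → ⟦ nLow p ≡ᵇ 0 ⟧ * F p) ≡ F (λ _ → zero)
  ΣLow₀ zero F r = trans (+-identityʳ _) (r _ _ (λ ()))
  ΣLow₀ (suc m) F r = begin
    ΣMaps m (suc K) (λ p → ⟦ nLow p ≡ᵇ 0 ⟧ * F (extend zero p)) + Σᶠ (λ α → ΣMaps m (suc K) (λ p → 0 * F (extend (suc α) p)))
      ≡⟨ cong₂ _+_ (ΣLow₀ m (λ p → F (extend zero p)) (Extensional-extend F r zero))
                   (Σ-zero {K} {λ α → ΣMaps m (suc K) (λ p → 0 * F (extend (suc α) p))} (λ α → ΣMaps-zero m (suc K) (λ p → refl))) ⟩
    F (extend zero (λ _ → zero)) + 0 ≡⟨ +-identityʳ _ ⟩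
    F (extend zero (λ _ → zero)) ≡⟨ r (extend zero (λ _ → zero)) (λ _ → zero) (λ { zero → refl ; (suc i) → refl }) ⟩
    F (λ _ → zero) ∎

  ΣLow₁ : ∀ m (F : (Fin m → L) → ℕ) → Extensional F → ΣMaps m (suc K) (λ p → ⟦ nLow p ≡ᵇ 1 ⟧ * F p) ≡ Σᶠ (λ a → Σᶠ (λ α → F (δ1 a α)))
  ΣLow₁ zero F r = refl
  ΣLow₁ (suc m) F r = begin
    ΣMaps m (suc K) (λ p → ⟦ nLow p ≡ᵇ 1 ⟧ * F (extend zero p)) + Σᶠ (λ α → ΣMaps m (suc K) (λ p → ⟦ nLow p ≡ᵇ 0 ⟧ * F (extend (suc α) p)))
      ≡⟨ cong₂ _+_ (ΣLow₁ m (λ p → F (extend zero p)) (Extensional-extend F r zero)) (Σ-cong (λ α → ΣLow₀ m (λ p → F (extend (suc α) p)) (Extensional-extend F r (suc α)))) ⟩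
    A + B
      ≡⟨ +-comm A B ⟩
    B + A
      ≡⟨ cong₂ _+_ (Σ-cong (λ α → r (extend (suc α) (λ _ → zero)) (δ1 zero α) (λ { zero → refl ; (suc i) → refl })))
                   (Σ-cong (λ a → Σ-cong (λ α → r (extend zero (δ1 a α)) (δ1 (suc a) α) (λ { zero → refl ; (suc i) → refl })))) ⟩
    Σᶠ (λ α → F (δ1 zero α)) + Σᶠ (λ a → Σᶠ (λ α → F (δ1 (suc a) α))) ∎
    where
    A : ℕ
    A = Σᶠ (λ a → Σᶠ (λ α → F (extend zero (δ1 a α))))
    B : ℕ
    B = Σᶠ {K} (λ α → F (extend (suc α) (λ _ → zero)))

  ΣLow₂ : ∀ m (F : (Fin m → L) → ℕ) → Extensional F → ΣMaps m (suc K) (λ p → ⟦ nLow p ≡ᵇ 2 ⟧ * F p) ≡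
       Σᶠ (λ a → Σᶠ (λ b → ⟦ ltF a b ⟧ * Σᶠ (λ α → Σᶠ (λ β → F (δ2 a α b β)))))
  ΣLow₂ zero F r = refl
  ΣLow₂ (suc m) F r = begin
    ΣMaps m (suc K) (λ p → ⟦ nLow p ≡ᵇ 2 ⟧ * F (extend zero p)) + Σᶠ (λ α → ΣMaps m (suc K) (λ p → ⟦ nLow p ≡ᵇ 1 ⟧ * F (extend (suc α) p)))
      ≡⟨ cong₂ _+_ (ΣLow₂ m (λ p → F (extend zero p)) (Extensional-extend F r zero)) (Σ-cong (λ α → ΣLow₁ m (λ p → F (extend (suc α) p)) (Extensional-extend F r (suc α)))) ⟩
    A + B ≡⟨ +-comm A B ⟩
    B + A ≡⟨ cong₂ _+_ (trans (Σ-swap (λ α b → Σᶠ (λ β → F (extend (suc α) (δ1 b β))))) (sym R0)) (sym R1) ⟩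
    Σᶠ {suc m} (λ b → ⟦ ltF zero b ⟧ * X zero b) + Σᶠ (λ a → Σᶠ (λ b → ⟦ ltF (suc a) b ⟧ * X (suc a) b)) ∎
    where
    X : Fin (suc m) → Fin (suc m) → ℕ
    X a b = Σᶠ (λ α → Σᶠ (λ β → F (δ2 a α b β)))
    A : ℕ
    A = Σᶠ (λ a → Σᶠ (λ b → ⟦ ltF a b ⟧ * Σᶠ (λ α → Σᶠ (λ β → F (extend zero (δ2 a α b β))))))
    B : ℕ
    B = Σᶠ (λ α → Σᶠ (λ b → Σᶠ (λ β → F (extend (suc α) (δ1 b β)))))
    R0 : Σᶠ {suc m} (λ b → ⟦ ltF zero b ⟧ * X zero b) ≡ Σᶠ (λ b → Σᶠ (λ α → Σᶠ (λ β → F (extend (suc α) (δ1 b β)))))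
    R0 = Σ-cong (λ b → trans (+-identityʳ _) (Σ-cong (λ α → Σ-cong (λ β →
           r (δ2 zero α (suc b) β) (extend (suc α) (δ1 b β)) (λ { zero → refl ; (suc i) → refl })))))
    R1 : Σᶠ (λ a → Σᶠ (λ b → ⟦ ltF (suc a) b ⟧ * X (suc a) b)) ≡ A
    R1 = Σ-cong (λ a → Σ-cong (λ b → cong (⟦ ltF a b ⟧ *_) (Σ-cong (λ α → Σ-cong (λ β →
           r (δ2 (suc a) α (suc b) β) (extend zero (δ2 a α b β)) (λ { zero → refl ; (suc i) → refl }))))))

  moveΣ : ∀ {p q s} (t : Fin q → Fin s → ℕ) (f : Fin p → Fin q → Fin s → ℕ) →
    Σᶠ (λ b → Σᶠ (λ c → t b c * Σᶠ (λ α → f α b c))) ≡ Σᶠ (λ α → Σᶠ (λ b → Σᶠ (λ c → t b c * f α b c)))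
  moveΣ t f = begin
    Σᶠ (λ b → Σᶠ (λ c → t b c * Σᶠ (λ α → f α b c)))
      ≡⟨ Σ-cong (λ b → Σ-cong (λ c → sym (Σ-*ˡ (t b c) (λ α → f α b c)))) ⟩
    Σᶠ (λ b → Σᶠ (λ c → Σᶠ (λ α → t b c * f α b c)))
      ≡⟨ Σ-cong (λ b → Σ-swap (λ c α → t b c * f α b c)) ⟩
    Σᶠ (λ b → Σᶠ (λ α → Σᶠ (λ c → t b c * f α b c)))
      ≡⟨ Σ-swap (λ b α → Σᶠ (λ c → t b c * f α b c)) ⟩
    Σᶠ (λ α → Σᶠ (λ b → Σᶠ (λ c → t b c * f α b c))) ∎

  ΣLow₃ : ∀ m (F : (Fin m → L) → ℕ) → Extensional F → ΣMaps m (suc K) (λ p → ⟦ nLow p ≡ᵇ 3 ⟧ * F p) ≡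
       Σᶠ (λ a → Σᶠ (λ b → Σᶠ (λ c → ⟦ ltF a b ⟧ * (⟦ ltF b c ⟧ * Σᶠ (λ α → Σᶠ (λ β → Σᶠ (λ γ → F (δ3 a α b β c γ))))))))
  ΣLow₃ zero F r = refl
  ΣLow₃ (suc m) F r = begin
    ΣMaps m (suc K) (λ p → ⟦ nLow p ≡ᵇ 3 ⟧ * F (extend zero p)) + Σᶠ (λ α → ΣMaps m (suc K) (λ p → ⟦ nLow p ≡ᵇ 2 ⟧ * F (extend (suc α) p)))
      ≡⟨ cong₂ _+_ (ΣLow₃ m (λ p → F (extend zero p)) (Extensional-extend F r zero)) (Σ-cong (λ α → ΣLow₂ m (λ p → F (extend (suc α) p)) (Extensional-extend F r (suc α)))) ⟩
    A + B ≡⟨ +-comm A B ⟩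
    B + A ≡⟨ cong₂ _+_ (trans (sym (moveΣ (λ b c → ⟦ ltF b c ⟧) (λ α b c → Σᶠ (λ β → Σᶠ (λ γ → F (extend (suc α) (δ2 b β c γ))))))) (sym R0)) (sym R1) ⟩
    Σᶠ {suc m} (λ b → Σᶠ (λ c → ⟦ ltF zero b ⟧ * (⟦ ltF b c ⟧ * X zero b c))) +
      Σᶠ (λ a → Σᶠ (λ b → Σᶠ (λ c → ⟦ ltF (suc a) b ⟧ * (⟦ ltF b c ⟧ * X (suc a) b c)))) ∎
    where
    X : Fin (suc m) → Fin (suc m) → Fin (suc m) → ℕ
    X a b c = Σᶠ (λ α → Σᶠ (λ β → Σᶠ (λ γ → F (δ3 a α b β c γ))))
    A : ℕ
    A = Σᶠ (λ a → Σᶠ (λ b → Σᶠ (λ c → ⟦ ltF a b ⟧ * (⟦ ltF b c ⟧ * Σᶠ (λ α → Σᶠ (λ β → Σᶠ (λ γ → F (extend zero (δ3 a α b β c γ)))))))))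
    B : ℕ
    B = Σᶠ (λ α → Σᶠ (λ b → Σᶠ (λ c → ⟦ ltF b c ⟧ * Σᶠ (λ β → Σᶠ (λ γ → F (extend (suc α) (δ2 b β c γ)))))))
    R0 : Σᶠ {suc m} (λ b → Σᶠ (λ c → ⟦ ltF zero b ⟧ * (⟦ ltF b c ⟧ * X zero b c))) ≡
         Σᶠ (λ b → Σᶠ (λ c → ⟦ ltF b c ⟧ * Σᶠ (λ α → Σᶠ (λ β → Σᶠ (λ γ → F (extend (suc α) (δ2 b β c γ)))))))
    R0 = trans (cong (_+ Σᶠ (λ b → Σᶠ (λ c → ⟦ ltF zero (suc b) ⟧ * (⟦ ltF (suc b) c ⟧ * X zero (suc b) c))))
                  (Σ-zero {suc m} {λ c → 0} (λ c → refl)))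
          (Σ-cong (λ b → Σ-cong (λ c → trans (+-identityʳ _) (cong (⟦ ltF b c ⟧ *_)
             (Σ-cong (λ α → Σ-cong (λ β → Σ-cong (λ γ →
               r (δ3 zero α (suc b) β (suc c) γ) (extend (suc α) (δ2 b β c γ)) (λ { zero → refl ; (suc i) → refl })))))))))
    R1 : Σᶠ (λ a → Σᶠ (λ b → Σᶠ (λ c → ⟦ ltF (suc a) b ⟧ * (⟦ ltF b c ⟧ * X (suc a) b c)))) ≡ A
    R1 = Σ-cong (λ a → trans (cong (_+ Σᶠ (λ b → Σᶠ (λ c → ⟦ ltF (suc a) (suc b) ⟧ * (⟦ ltF (suc b) c ⟧ * X (suc a) (suc b) c))))
                  (Σ-zero {suc m} {λ c → 0} (λ c → refl)))
          (Σ-cong (λ b → trans (cong (_+ Σᶠ (λ c → ⟦ ltF a b ⟧ * (⟦ ltF b c ⟧ * X (suc a) (suc b) (suc c)))) (*-zeroʳ ⟦ ltF a b ⟧))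
             (Σ-cong (λ c → cong (λ t → ⟦ ltF a b ⟧ * (⟦ ltF b c ⟧ * t))
               (Σ-cong (λ α → Σ-cong (λ β → Σ-cong (λ γ →
                 r (δ3 (suc a) α (suc b) β (suc c) γ) (extend zero (δ3 a α b β c γ)) (λ { zero → refl ; (suc i) → refl }))))))))))

bool-ext : ∀ x y → (x ≡ true → y ≡ true) → (y ≡ true → x ≡ true) → x ≡ y
bool-ext true y f g = sym (f refl)
bool-ext false true f g = g refl
bool-ext false false f g = refl

allᵇ-T : ∀ {m} (g : Fin m → Bool) → allᵇ g ≡ true → ∀ i → g i ≡ true
allᵇ-T {suc m} g e zero with g zero
... | true = refl
allᵇ-T {suc m} g e (suc i) with g zero
... | true = allᵇ-T (λ j → g (suc j)) e i

∧-true₁ : ∀ {a b} → a ∧ b ≡ true → a ≡ true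
∧-true₁ {true} e = refl
∧-true₂ : ∀ {a b} → a ∧ b ≡ true → b ≡ true
∧-true₂ {true} e = e

allᵇ-3 : ∀ {m} (g : Fin m → Bool) (a b c : Fin m) →
  (∀ v → eqF v a ≡ false → eqF v b ≡ false → eqF v c ≡ false → g v ≡ true) → allᵇ g ≡ g a ∧ (g b ∧ g c)
allᵇ-3 g a b c h = bool-ext _ _
  (λ e → let t = allᵇ-T g e in cong₂ _∧_ (t a) (cong₂ _∧_ (t b) (t c)))
  (λ e → allᵇ-true (λ v → pt v e))
  where
  pt : ∀ v → g a ∧ (g b ∧ g c) ≡ true → g v ≡ true
  pt v e with eqF v a in e1 | eqF v b in e2 | eqF v c in e3
  ... | true | _ | _ rewrite eqF-true v a e1 = ∧-true₁ e
  ... | false | true | _ rewrite eqF-true v b e2 = ∧-true₁ (∧-true₂ {g a} e)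
  ... | false | false | true rewrite eqF-true v c e3 = ∧-true₂ {g b} (∧-true₂ {g a} e)
  ... | false | false | false = h v e1 e2 e3

module LowEval {n} (G : Graph n) (k y' : ℕ) where
  open LowHigh G k y'
  open HighCount G k y'
  open FewLow K

  noLowClash : (Fin n → Low) → Fin n → Fin n → Bool
  noLowClash p u v = not (adj G u v ∧ lowEq (p u) (p v))

  SupportedOn : (Fin n → Low) → Fin n → Fin n → Fin n → Set
  SupportedOn p a b c = ∀ z → eqF z a ≡ false → eqF z b ≡ false → eqF z c ≡ false → p z ≡ zero

  properLow-on3 : ∀ p a b c → SupportedOn p a b c → properLow p ≡
    (noLowClash p a a ∧ (noLowClash p a b ∧ noLowClash p a c)) ∧ ((noLowClash p b a ∧ (noLowClash p b b ∧ noLowClash p b c)) ∧ (noLowClash p c a ∧ (noLowClash p c b ∧ noLowClash p c c)))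
  properLow-on3 p a b c sp = trans (allᵇ-3 (λ u → allᵇ (noLowClash p u)) a b c out)
    (cong₂ _∧_ (inn a) (cong₂ _∧_ (inn b) (inn c)))
    where
    inn : ∀ u → allᵇ (noLowClash p u) ≡ noLowClash p u a ∧ (noLowClash p u b ∧ noLowClash p u c)
    inn u = allᵇ-3 (noLowClash p u) a b c (λ v e1 e2 e3 →
      trans (cong (λ t → not (adj G u v ∧ lowEq (p u) t)) (sp v e1 e2 e3)) (cong not (high-never-clashes (adj G u v) (p u))))
      where
      high-never-clashes : ∀ e l → e ∧ lowEq l zero ≡ false
      high-never-clashes e zero = ∧-zeroʳ e
      high-never-clashes e (suc _) = ∧-zeroʳ e
    out : ∀ u → eqF u a ≡ false → eqF u b ≡ false → eqF u c ≡ false → allᵇ (noLowClash p u) ≡ true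
    out u e1 e2 e3 = allᵇ-true (λ v →
      trans (cong (λ t → not (adj G u v ∧ lowEq t (p v))) (sp u e1 e2 e3)) (cong not (∧-zeroʳ (adj G u v))))

  permittedLow-on3 : ∀ r p a b c → SupportedOn p a b c → permittedLow r p ≡ permit (forb r a) (p a) ∧ (permit (forb r b) (p b) ∧ permit (forb r c) (p c))
  permittedLow-on3 r p a b c sp = allᵇ-3 (λ v → permit (forb r v) (p v)) a b c (λ v e1 e2 e3 → cong (permit (forb r v)) (sp v e1 e2 e3))

  ltF-ne : ∀ {a b : Fin n} → ltF a b ≡ true → eqF a b ≡ false
  ltF-ne {a} {b} lt with eqF a b in e
  ... | false = refl
  ... | true rewrite eqF-true a b e = ⊥-elim (<-irrefl refl (<ᵇ⇒< (toℕ b) (toℕ b) (subst Data.Bool.T (sym lt) _)))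

  ltF-ne' : ∀ {a b : Fin n} → ltF a b ≡ true → eqF b a ≡ false
  ltF-ne' {a} {b} lt = trans (eqF-sym b a) (ltF-ne {a} {b} lt)

  ltF-trans : ∀ {a b c : Fin n} → ltF a b ≡ true → ltF b c ≡ true → ltF a c ≡ true
  ltF-trans {a} {b} {c} l1 l2 = toT {a} {c} (<-trans (fromT {a} {b} l1) (fromT {b} {c} l2))
    where
    fromT : ∀ {u v : Fin n} → ltF u v ≡ true → toℕ u < toℕ v
    fromT {u} {v} e = <ᵇ⇒< (toℕ u) (toℕ v) (subst Data.Bool.T (sym e) _)
    toT : ∀ {u v : Fin n} → toℕ u < toℕ v → ltF u v ≡ true
    toT {u} {v} lt with ltF u v | <⇒<ᵇ lt
    ... | true | _ = refl

  irr : ∀ u (t : Bool) → not (adj G u u ∧ t) ≡ true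
  irr u t rewrite irrefl G u = refl

  hsym : ∀ u v (α β : Fin K) → not (adj G v u ∧ eqF β α) ≡ not (adj G u v ∧ eqF α β)
  hsym u v α β = cong₂ (λ s t → not (s ∧ t)) (gsym G v u) (eqF-sym β α)

  bool3 : ∀ x y z → (true ∧ (x ∧ z)) ∧ ((x ∧ (true ∧ y)) ∧ (z ∧ (y ∧ true))) ≡ x ∧ (y ∧ z)
  bool3 true true true = refl
  bool3 true true false = refl
  bool3 true false true = refl
  bool3 true false false = refl
  bool3 false y true = refl
  bool3 false y false = refl

  pmz : ∀ (p q : Bool) → p ∧ (q ∧ q) ≡ p ∧ q
  pmz p true = refl
  pmz p false = refl

  if-t : ∀ {A : Set} {b : Bool} {x y : A} → b ≡ true → (if b then x else y) ≡ x
  if-t refl = refl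
  if-f : ∀ {A : Set} {b : Bool} {x y : A} → b ≡ false → (if b then x else y) ≡ y
  if-f refl = refl

  module TriplePattern (a b c : Fin n) (α β γ : Fin K) (lab : ltF a b ≡ true) (lbc : ltF b c ≡ true) where
    p : Fin n → Low
    p = δ3 a α b β c γ
    lac : ltF a c ≡ true
    lac = ltF-trans {a} {b} {c} lab lbc
    pa : p a ≡ suc α
    pa = if-t (eqF-refl a)
    pb : p b ≡ suc β
    pb = trans (if-f (ltF-ne' {a} {b} lab)) (if-t (eqF-refl b))
    pc : p c ≡ suc γ
    pc = trans (if-f (ltF-ne' {a} {c} lac)) (trans (if-f (ltF-ne' {b} {c} lbc)) (if-t (eqF-refl c)))
    sp : SupportedOn p a b c
    sp z e1 e2 e3 rewrite e1 | e2 | e3 = refl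
    nx : Bool
    nx = not (adj G a b ∧ eqF α β)
    ny : Bool
    ny = not (adj G b c ∧ eqF β γ)
    nz : Bool
    nz = not (adj G a c ∧ eqF α γ)
    goodLow₃ : ∀ r → goodLow r p ≡ (nx ∧ (ny ∧ nz)) ∧ (not (lookup (forb r a) α) ∧ (not (lookup (forb r b) β) ∧ not (lookup (forb r c) γ)))
    goodLow₃ r = cong₂ _∧_
      (trans (properLow-on3 p a b c sp)
        (trans (cong₂ (λ s t → s ∧ t)
                 (cong₂ (λ s t → s ∧ t) (irr a _) (cong₂ _∧_ hab hac))
                 (cong₂ _∧_ (cong₂ _∧_ hba (cong₂ _∧_ (irr b _) hbc)) (cong₂ _∧_ hca (cong₂ _∧_ hcb (irr c _)))))
          (bool3 nx ny nz)))
      (trans (permittedLow-on3 r p a b c sp) (cong₂ (λ s t → permit (forb r a) s ∧ t) pa (cong₂ (λ s t → permit (forb r b) s ∧ permit (forb r c) t) pb pc)))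
      where
      hab : noLowClash p a b ≡ nx
      hab rewrite pa | pb = refl
      hac : noLowClash p a c ≡ nz
      hac rewrite pa | pc = refl
      hbc : noLowClash p b c ≡ ny
      hbc rewrite pb | pc = refl
      hba : noLowClash p b a ≡ nx
      hba rewrite pb | pa = hsym a b α β
      hca : noLowClash p c a ≡ nz
      hca rewrite pc | pa = hsym a c α γ
      hcb : noLowClash p c b ≡ ny
      hcb rewrite pc | pb = hsym b c β γ

  bool2 : ∀ x → (true ∧ (x ∧ x)) ∧ ((x ∧ (true ∧ true)) ∧ (x ∧ (true ∧ true))) ≡ x
  bool2 true = refl
  bool2 false = refl

  module PairPattern (a b : Fin n) (α β : Fin K) (lab : ltF a b ≡ true) where
    p : Fin n → Low
    p = δ2 a α b β
    pa : p a ≡ suc α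
    pa = if-t (eqF-refl a)
    pb : p b ≡ suc β
    pb = trans (if-f (ltF-ne' {a} {b} lab)) (if-t (eqF-refl b))
    sp : SupportedOn p a b b
    sp z e1 e2 e3 rewrite e1 | e2 = refl
    nx : Bool
    nx = not (adj G a b ∧ eqF α β)
    goodLow₂ : ∀ r → goodLow r p ≡ nx ∧ (not (lookup (forb r a) α) ∧ not (lookup (forb r b) β))
    goodLow₂ r = cong₂ _∧_
      (trans (properLow-on3 p a b b sp)
        (trans (cong₂ (λ s t → s ∧ t)
                 (cong₂ (λ s t → s ∧ t) (irr a _) (cong₂ _∧_ hab hab))
                 (cong₂ _∧_ (cong₂ _∧_ hba (cong₂ _∧_ (irr b _) (irr b _))) (cong₂ _∧_ hba (cong₂ _∧_ (irr b _) (irr b _)))))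
          (bool2 nx)))
      (trans (permittedLow-on3 r p a b b sp) (trans (pmz (permit (forb r a) (p a)) (permit (forb r b) (p b))) (cong₂ (λ s t → permit (forb r a) s ∧ permit (forb r b) t) pa pb)))
      where
      hab : noLowClash p a b ≡ nx
      hab rewrite pa | pb = refl
      hba : noLowClash p b a ≡ nx
      hba rewrite pb | pa = hsym a b α β

  module SinglePattern (a : Fin n) (α : Fin K) where
    p : Fin n → Low
    p = δ1 a α
    pa : p a ≡ suc α
    pa = if-t (eqF-refl a)
    sp : SupportedOn p a a a
    sp z e1 e2 e3 rewrite e1 = refl
    goodLow₁ : ∀ r → goodLow r p ≡ not (lookup (forb r a) α)
    goodLow₁ r = cong₂ _∧_
      (trans (properLow-on3 p a a a sp)
        (cong₂ (λ s t → s ∧ t) (cong₂ (λ s t → s ∧ t) (irr a _) (cong₂ _∧_ (irr a _) (irr a _)))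
                 (cong₂ _∧_ (cong₂ _∧_ (irr a _) (cong₂ _∧_ (irr a _) (irr a _))) (cong₂ _∧_ (irr a _) (cong₂ _∧_ (irr a _) (irr a _))))))
      (trans (permittedLow-on3 r p a a a sp) (trans (pmz (permit (forb r a) (p a)) (permit (forb r a) (p a))) (trans (pmz' (permit (forb r a) (p a))) (cong (permit (forb r a)) pa))))
      where
      pmz' : ∀ q → q ∧ q ≡ q
      pmz' true = refl
      pmz' false = refl

  mask₁ : Fin n → Fin n → Bool
  mask₁ a z = eqF z a
  mask₂ : Fin n → Fin n → Fin n → Bool
  mask₂ a b z = eqF z a ∨ eqF z b
  mask₃ : Fin n → Fin n → Fin n → Fin n → Bool
  mask₃ a b c z = eqF z a ∨ (eqF z b ∨ eqF z c)

  lowMask₁ : ∀ a α z → lowMask (δ1 a α) z ≡ mask₁ a z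
  lowMask₁ a α z with eqF z a
  ... | true = refl
  ... | false = refl

  lowMask₂ : ∀ a α b β z → lowMask (δ2 a α b β) z ≡ mask₂ a b z
  lowMask₂ a α b β z with eqF z a
  ... | true = refl
  ... | false with eqF z b
  ... | true = refl
  ... | false = refl

  lowMask₃ : ∀ a α b β c γ z → lowMask (δ3 a α b β c γ) z ≡ mask₃ a b c z
  lowMask₃ a α b β c γ z with eqF z a
  ... | true = refl
  ... | false with eqF z b
  ... | true = refl
  ... | false with eqF z c
  ... | true = refl
  ... | false = refl

  ne-ab : ∀ {z a b : Fin n} → eqF z a ≡ true → eqF z b ≡ true → eqF a b ≡ false → ⊥
  ne-ab {z} {a} {b} e1 e2 e3 rewrite sym (eqF-true z a e1) | e2 = case e3 of λ ()

  lowMask₂-count : ∀ a b → ltF a b ≡ true → ∀ z → ⟦ mask₂ a b z ⟧ ≡ ⟦ eqF z a ⟧ + ⟦ eqF z b ⟧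
  lowMask₂-count a b lab z with eqF z a in e1 | eqF z b in e2
  ... | true | true = ⊥-elim (ne-ab {z} {a} {b} e1 e2 (ltF-ne {a} {b} lab))
  ... | true | false = refl
  ... | false | true = refl
  ... | false | false = refl

  lowMask₃-count : ∀ a b c → ltF a b ≡ true → ltF b c ≡ true → ∀ z → ⟦ mask₃ a b c z ⟧ ≡ ⟦ eqF z a ⟧ + (⟦ eqF z b ⟧ + ⟦ eqF z c ⟧)
  lowMask₃-count a b c lab lbc z with eqF z a in e1 | eqF z b in e2 | eqF z c in e3
  ... | true | true | _ = ⊥-elim (ne-ab {z} {a} {b} e1 e2 (ltF-ne {a} {b} lab))
  ... | true | false | true = ⊥-elim (ne-ab {z} {a} {c} e1 e3 (ltF-ne {a} {c} (ltF-trans {a} {b} {c} lab lbc)))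
  ... | false | true | true = ⊥-elim (ne-ab {z} {b} {c} e2 e3 (ltF-ne {b} {c} lbc))
  ... | true | false | false = refl
  ... | false | true | false = refl
  ... | false | false | true = refl
  ... | false | false | false = refl

  nHigh₂ : ∀ a b → ltF a b ≡ true → 2 + nHigh (mask₂ a b) ≡ n
  nHigh₂ a b lab = trans (cong (_+ nHigh (mask₂ a b)) (sym (trans (Σ-cong (lowMask₂-count a b lab))
     (trans (Σ-+ (λ (z : Fin n) → ⟦ eqF z a ⟧) (λ (z : Fin n) → ⟦ eqF z b ⟧)) (cong₂ _+_ (Σ-indicator a) (Σ-indicator b)))))) (nLow+nHigh (mask₂ a b))

  nHigh₃ : ∀ a b c → ltF a b ≡ true → ltF b c ≡ true → 3 + nHigh (mask₃ a b c) ≡ n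
  nHigh₃ a b c lab lbc = trans (cong (_+ nHigh (mask₃ a b c)) (sym (trans (Σ-cong (lowMask₃-count a b c lab lbc))
     (trans (Σ-+ (λ (z : Fin n) → ⟦ eqF z a ⟧) (λ (z : Fin n) → ⟦ eqF z b ⟧ + ⟦ eqF z c ⟧))
       (cong₂ _+_ (Σ-indicator a) (trans (Σ-+ (λ (z : Fin n) → ⟦ eqF z b ⟧) (λ (z : Fin n) → ⟦ eqF z c ⟧)) (cong₂ _+_ (Σ-indicator b) (Σ-indicator c)))))))) (nLow+nHigh (mask₃ a b c))

card : ∀ {m} (s : Subset m) → ∣ s ∣ ≡ Σᶠ (λ α → ⟦ lookup s α ⟧)
card [] = refl
card (true ∷ s) = cong suc (card s)
card (false ∷ s) = card s

lookup∩ : ∀ {m} (s t : Subset m) α → lookup (s ∩ t) α ≡ lookup s α ∧ lookup t α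
lookup∩ (x ∷ s) (y ∷ t) zero = refl
lookup∩ (x ∷ s) (y ∷ t) (suc α) = lookup∩ s t α

card∩ : ∀ {m} (s t : Subset m) → ∣ s ∩ t ∣ ≡ Σᶠ (λ α → ⟦ lookup s α ∧ lookup t α ⟧)
card∩ s t = trans (card (s ∩ t)) (Σ-cong (λ α → cong ⟦_⟧ (lookup∩ s t α)))

∩-comm-card : ∀ {m} (s t : Subset m) → ∣ s ∩ t ∣ ≡ ∣ t ∩ s ∣
∩-comm-card s t = trans (card∩ s t) (trans (Σ-cong (λ α → cong ⟦_⟧ (∧-comm (lookup s α) (lookup t α)))) (sym (card∩ t s)))

nAllowed : ∀ {m} → Subset m → ℕ
nAllowed s = Σᶠ (λ α → ⟦ not (lookup s α) ⟧)

nAllowed+card : ∀ {m} (s : Subset m) → nAllowed s + ∣ s ∣ ≡ m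
nAllowed+card {m} s = trans (cong (nAllowed s +_) (card s)) (trans (sym (Σ-+ (λ α → ⟦ not (lookup s α) ⟧) (λ α → ⟦ lookup s α ⟧)))
  (trans (Σ-cong (λ α → trans (+-comm ⟦ not (lookup s α) ⟧ _) (⟦not⟧+ (lookup s α)))) (trans (Σ-const m 1) (*-identityʳ m))))

nAllowed₂ : ∀ {m} → Subset m → Subset m → ℕ
nAllowed₂ s t = Σᶠ (λ α → ⟦ not (lookup s α) ⟧ * ⟦ not (lookup t α) ⟧)

IE2 : ∀ a b → ⟦ not a ⟧ * ⟦ not b ⟧ + ⟦ a ⟧ + ⟦ b ⟧ ≡ 1 + ⟦ a ∧ b ⟧
IE2 true true = refl
IE2 true false = refl
IE2 false true = refl
IE2 false false = refl

nAllowed₂-incl-excl : ∀ {m} (s t : Subset m) → nAllowed₂ s t + ∣ s ∣ + ∣ t ∣ ≡ m + ∣ s ∩ t ∣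
nAllowed₂-incl-excl {m} s t = begin
  nAllowed₂ s t + ∣ s ∣ + ∣ t ∣ ≡⟨ cong₂ (λ u v → nAllowed₂ s t + u + v) (card s) (card t) ⟩
  nAllowed₂ s t + Σᶠ (λ α → ⟦ lookup s α ⟧) + Σᶠ (λ α → ⟦ lookup t α ⟧)
    ≡⟨ cong (_+ Σᶠ (λ α → ⟦ lookup t α ⟧)) (sym (Σ-+ (λ α → ⟦ not (lookup s α) ⟧ * ⟦ not (lookup t α) ⟧) (λ α → ⟦ lookup s α ⟧))) ⟩
  Σᶠ (λ α → ⟦ not (lookup s α) ⟧ * ⟦ not (lookup t α) ⟧ + ⟦ lookup s α ⟧) + Σᶠ (λ α → ⟦ lookup t α ⟧)
    ≡⟨ sym (Σ-+ (λ α → ⟦ not (lookup s α) ⟧ * ⟦ not (lookup t α) ⟧ + ⟦ lookup s α ⟧) (λ α → ⟦ lookup t α ⟧)) ⟩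
  Σᶠ (λ α → ⟦ not (lookup s α) ⟧ * ⟦ not (lookup t α) ⟧ + ⟦ lookup s α ⟧ + ⟦ lookup t α ⟧)
    ≡⟨ Σ-cong (λ α → IE2 (lookup s α) (lookup t α)) ⟩
  Σᶠ (λ α → 1 + ⟦ lookup s α ∧ lookup t α ⟧)
    ≡⟨ Σ-+ (λ _ → 1) (λ α → ⟦ lookup s α ∧ lookup t α ⟧) ⟩
  Σᶠ {m} (λ _ → 1) + Σᶠ (λ α → ⟦ lookup s α ∧ lookup t α ⟧)
    ≡⟨ cong₂ _+_ (trans (Σ-const m 1) (*-identityʳ m)) (sym (card∩ s t)) ⟩
  m + ∣ s ∩ t ∣ ∎

IE3 : ∀ x y z → ⟦ not x ⟧ * (⟦ not y ⟧ * ⟦ not z ⟧) + (⟦ x ⟧ + ⟦ y ⟧ + ⟦ z ⟧) + ⟦ x ∧ (y ∧ z) ⟧ ≡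
                1 + (⟦ x ∧ y ⟧ + ⟦ y ∧ z ⟧ + ⟦ x ∧ z ⟧)
IE3 true true true = refl
IE3 true true false = refl
IE3 true false true = refl
IE3 true false false = refl
IE3 false true true = refl
IE3 false true false = refl
IE3 false false true = refl
IE3 false false false = refl

nAllowed₃ : ∀ {m} → Subset m → Subset m → Subset m → ℕ
nAllowed₃ s t u = Σᶠ (λ α → ⟦ not (lookup s α) ⟧ * (⟦ not (lookup t α) ⟧ * ⟦ not (lookup u α) ⟧))

nCommon₃ : ∀ {m} → Subset m → Subset m → Subset m → ℕ
nCommon₃ s t u = Σᶠ (λ α → ⟦ lookup s α ∧ (lookup t α ∧ lookup u α) ⟧)

nAllowed₃-incl-excl : ∀ {m} (s t u : Subset m) → nAllowed₃ s t u + (∣ s ∣ + ∣ t ∣ + ∣ u ∣) + nCommon₃ s t u ≡ m + (∣ s ∩ t ∣ + ∣ t ∩ u ∣ + ∣ s ∩ u ∣)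
nAllowed₃-incl-excl {m} s t u = begin
  nAllowed₃ s t u + (∣ s ∣ + ∣ t ∣ + ∣ u ∣) + nCommon₃ s t u
    ≡⟨ cong (λ v → nAllowed₃ s t u + v + nCommon₃ s t u) (cong₂ _+_ (cong₂ _+_ (card s) (card t)) (card u)) ⟩
  nAllowed₃ s t u + (Σᶠ (λ α → ⟦ inS α ⟧) + Σᶠ (λ α → ⟦ inT α ⟧) + Σᶠ (λ α → ⟦ inU α ⟧)) + nCommon₃ s t u
    ≡⟨ cong (λ v → nAllowed₃ s t u + v + nCommon₃ s t u) (trans (cong (_+ Σᶠ (λ α → ⟦ inU α ⟧)) (sym (Σ-+ (λ α → ⟦ inS α ⟧) (λ α → ⟦ inT α ⟧))))
          (sym (Σ-+ (λ α → ⟦ inS α ⟧ + ⟦ inT α ⟧) (λ α → ⟦ inU α ⟧)))) ⟩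
  nAllowed₃ s t u + Σᶠ (λ α → ⟦ inS α ⟧ + ⟦ inT α ⟧ + ⟦ inU α ⟧) + nCommon₃ s t u
    ≡⟨ cong (_+ nCommon₃ s t u) (sym (Σ-+ (λ α → ⟦ not (inS α) ⟧ * (⟦ not (inT α) ⟧ * ⟦ not (inU α) ⟧)) (λ α → ⟦ inS α ⟧ + ⟦ inT α ⟧ + ⟦ inU α ⟧))) ⟩
  Σᶠ (λ α → ⟦ not (inS α) ⟧ * (⟦ not (inT α) ⟧ * ⟦ not (inU α) ⟧) + (⟦ inS α ⟧ + ⟦ inT α ⟧ + ⟦ inU α ⟧)) + nCommon₃ s t u
    ≡⟨ sym (Σ-+ (λ α → ⟦ not (inS α) ⟧ * (⟦ not (inT α) ⟧ * ⟦ not (inU α) ⟧) + (⟦ inS α ⟧ + ⟦ inT α ⟧ + ⟦ inU α ⟧)) (λ α → ⟦ inS α ∧ (inT α ∧ inU α) ⟧)) ⟩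
  Σᶠ (λ α → ⟦ not (inS α) ⟧ * (⟦ not (inT α) ⟧ * ⟦ not (inU α) ⟧) + (⟦ inS α ⟧ + ⟦ inT α ⟧ + ⟦ inU α ⟧) + ⟦ inS α ∧ (inT α ∧ inU α) ⟧)
    ≡⟨ Σ-cong (λ α → IE3 (inS α) (inT α) (inU α)) ⟩
  Σᶠ (λ α → 1 + (⟦ inS α ∧ inT α ⟧ + ⟦ inT α ∧ inU α ⟧ + ⟦ inS α ∧ inU α ⟧))
    ≡⟨ Σ-+ (λ _ → 1) (λ α → ⟦ inS α ∧ inT α ⟧ + ⟦ inT α ∧ inU α ⟧ + ⟦ inS α ∧ inU α ⟧) ⟩
  Σᶠ {m} (λ _ → 1) + Σᶠ (λ α → ⟦ inS α ∧ inT α ⟧ + ⟦ inT α ∧ inU α ⟧ + ⟦ inS α ∧ inU α ⟧)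
    ≡⟨ cong₂ _+_ (trans (Σ-const m 1) (*-identityʳ m))
         (trans (Σ-+ (λ α → ⟦ inS α ∧ inT α ⟧ + ⟦ inT α ∧ inU α ⟧) (λ α → ⟦ inS α ∧ inU α ⟧))
           (cong₂ _+_ (trans (Σ-+ (λ α → ⟦ inS α ∧ inT α ⟧) (λ α → ⟦ inT α ∧ inU α ⟧)) (cong₂ _+_ (sym (card∩ s t)) (sym (card∩ t u))))
             (sym (card∩ s u)))) ⟩
  m + (∣ s ∩ t ∣ + ∣ t ∩ u ∣ + ∣ s ∩ u ∣) ∎
  where
  inS inT inU : Fin m → Bool
  inS = lookup s
  inT = lookup t
  inU = lookup u

-- Pointwise inclusion–exclusion behind the three-vertex count: for colour coincidences
-- e1 = [α = β], e2 = [β = γ], e3 = [α = γ] (consistent by transitivity) and edge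
-- indicators A, B, C, the "no monochromatic edge" indicator expands as below.
incl-excl₃ : ∀ A B C e1 e2 e3 → (e1 ∧ e2) ∧ not e3 ≡ false → (e1 ∧ e3) ∧ not e2 ≡ false → (e2 ∧ e3) ∧ not e1 ≡ false →
  ⟦ not (A ∧ e1) ∧ (not (B ∧ e2) ∧ not (C ∧ e3)) ⟧ + (⟦ A ⟧ * ⟦ e1 ⟧ + ⟦ B ⟧ * ⟦ e2 ⟧ + ⟦ C ⟧ * ⟦ e3 ⟧)
    + ⟦ A ∧ (B ∧ C) ⟧ * (⟦ e1 ⟧ * ⟦ e3 ⟧)
  ≡ 1 + (⟦ A ∧ B ⟧ + ⟦ B ∧ C ⟧ + ⟦ A ∧ C ⟧) * (⟦ e1 ⟧ * ⟦ e3 ⟧)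
incl-excl₃ A B C true true false () _ _
incl-excl₃ A B C true false true _ () _
incl-excl₃ A B C false true true _ _ ()
incl-excl₃ true true true true true true _ _ _ = refl
incl-excl₃ true true false true true true _ _ _ = refl
incl-excl₃ true false true true true true _ _ _ = refl
incl-excl₃ true false false true true true _ _ _ = refl
incl-excl₃ false true true true true true _ _ _ = refl
incl-excl₃ false true false true true true _ _ _ = refl
incl-excl₃ false false true true true true _ _ _ = refl
incl-excl₃ false false false true true true _ _ _ = refl
incl-excl₃ true true true true false false _ _ _ = refl
incl-excl₃ true true false true false false _ _ _ = refl
incl-excl₃ true false true true false false _ _ _ = refl
incl-excl₃ true false false true false false _ _ _ = refl
incl-excl₃ false true true true false false _ _ _ = refl
incl-excl₃ false true false true false false _ _ _ = refl
incl-excl₃ false false true true false false _ _ _ = refl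
incl-excl₃ false false false true false false _ _ _ = refl
incl-excl₃ true true true false true false _ _ _ = refl
incl-excl₃ true true false false true false _ _ _ = refl
incl-excl₃ true false true false true false _ _ _ = refl
incl-excl₃ true false false false true false _ _ _ = refl
incl-excl₃ false true true false true false _ _ _ = refl
incl-excl₃ false true false false true false _ _ _ = refl
incl-excl₃ false false true false true false _ _ _ = refl
incl-excl₃ false false false false true false _ _ _ = refl
incl-excl₃ true true true false false true _ _ _ = refl
incl-excl₃ true true false false false true _ _ _ = refl
incl-excl₃ true false true false false true _ _ _ = refl
incl-excl₃ true false false false false true _ _ _ = refl
incl-excl₃ false true true false false true _ _ _ = refl
incl-excl₃ false true false false false true _ _ _ = refl
incl-excl₃ false false true false false true _ _ _ = refl
incl-excl₃ false false false false false true _ _ _ = refl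
incl-excl₃ true true true false false false _ _ _ = refl
incl-excl₃ true true false false false false _ _ _ = refl
incl-excl₃ true false true false false false _ _ _ = refl
incl-excl₃ true false false false false false _ _ _ = refl
incl-excl₃ false true true false false false _ _ _ = refl
incl-excl₃ false true false false false false _ _ _ = refl
incl-excl₃ false false true false false false _ _ _ = refl
incl-excl₃ false false false false false false _ _ _ = refl

incl-excl₃-permitted : ∀ A B C e1 e2 e3 P → (e1 ∧ e2) ∧ not e3 ≡ false → (e1 ∧ e3) ∧ not e2 ≡ false → (e2 ∧ e3) ∧ not e1 ≡ false →
  ⟦ (not (A ∧ e1) ∧ (not (B ∧ e2) ∧ not (C ∧ e3))) ∧ P ⟧ + (⟦ A ⟧ * (⟦ e1 ⟧ * ⟦ P ⟧) + ⟦ B ⟧ * (⟦ e2 ⟧ * ⟦ P ⟧) + ⟦ C ⟧ * (⟦ e3 ⟧ * ⟦ P ⟧))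
    + ⟦ A ∧ (B ∧ C) ⟧ * (⟦ e1 ⟧ * (⟦ e3 ⟧ * ⟦ P ⟧))
  ≡ ⟦ P ⟧ + (⟦ A ∧ B ⟧ * (⟦ e1 ⟧ * (⟦ e3 ⟧ * ⟦ P ⟧)) + ⟦ B ∧ C ⟧ * (⟦ e1 ⟧ * (⟦ e3 ⟧ * ⟦ P ⟧)) + ⟦ A ∧ C ⟧ * (⟦ e1 ⟧ * (⟦ e3 ⟧ * ⟦ P ⟧)))
incl-excl₃-permitted A B C e1 e2 e3 P h1 h2 h3 = begin
  ⟦ N ∧ P ⟧ + _ + _
    ≡⟨ cong (λ t → t + (⟦ A ⟧ * (⟦ e1 ⟧ * ⟦ P ⟧) + ⟦ B ⟧ * (⟦ e2 ⟧ * ⟦ P ⟧) + ⟦ C ⟧ * (⟦ e3 ⟧ * ⟦ P ⟧))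
                     + ⟦ A ∧ (B ∧ C) ⟧ * (⟦ e1 ⟧ * (⟦ e3 ⟧ * ⟦ P ⟧))) (⟦∧⟧ N P) ⟩
  _ ≡⟨ factorˡ ⟦ N ⟧ ⟦ A ⟧ ⟦ B ⟧ ⟦ C ⟧ ⟦ e1 ⟧ ⟦ e2 ⟧ ⟦ e3 ⟧ ⟦ A ∧ (B ∧ C) ⟧ ⟦ P ⟧ ⟩
  _ ≡⟨ cong (_* ⟦ P ⟧) (incl-excl₃ A B C e1 e2 e3 h1 h2 h3) ⟩
  _ ≡⟨ factorʳ ⟦ A ∧ B ⟧ ⟦ B ∧ C ⟧ ⟦ A ∧ C ⟧ ⟦ e1 ⟧ ⟦ e3 ⟧ ⟦ P ⟧ ⟩
  _ ∎
  where
  N : Bool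
  N = not (A ∧ e1) ∧ (not (B ∧ e2) ∧ not (C ∧ e3))
  factorˡ : ∀ n a b c x1 x2 x3 abc p →
    n * p + (a * (x1 * p) + b * (x2 * p) + c * (x3 * p)) + abc * (x1 * (x3 * p))
    ≡ (n + (a * x1 + b * x2 + c * x3) + abc * (x1 * x3)) * p
  factorˡ = solve-∀
  factorʳ : ∀ ab bc ac x1 x3 p →
    (1 + (ab + bc + ac) * (x1 * x3)) * p ≡ p + (ab * (x1 * (x3 * p)) + bc * (x1 * (x3 * p)) + ac * (x1 * (x3 * p)))
  factorʳ = solve-∀

module ColourTuples (K : ℕ) where
  Σ³-last : ∀ (X : Fin K → Fin K → ℕ) (h : Fin K → ℕ) → Σ³ (λ α β γ → X α β * h γ) ≡ Σ² X * Σᶠ h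
  Σ³-last X h = trans (Σ-cong (λ α → trans (Σ-cong (λ β → Σ-*ˡ (X α β) h)) (Σ-*ʳ (Σᶠ h) (X α))))
     (Σ-*ʳ (Σᶠ h) (λ α → Σᶠ (X α)))

  Σ²-prod : ∀ (f g : Fin K → ℕ) → Σ² (λ α β → f α * g β) ≡ Σᶠ f * Σᶠ g
  Σ²-prod f g = trans (Σ-cong (λ α → Σ-*ˡ (f α) g)) (Σ-*ʳ (Σᶠ g) f)

  pt : ∀ (g : Fin K → ℕ) α → Σᶠ (λ β → ⟦ eqF α β ⟧ * g β) ≡ g α
  pt g α = trans (Σ-cong (λ β → cong (λ t → ⟦ t ⟧ * g β) (eqF-sym α β))) (Σ-point g α)

  Σ²-pt : ∀ (f g : Fin K → ℕ) → Σ² (λ α β → ⟦ eqF α β ⟧ * (f α * g β)) ≡ Σᶠ (λ α → f α * g α)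
  Σ²-pt f g = Σ-cong (λ α → trans (Σ-cong (λ β → r ⟦ eqF α β ⟧ (f α) (g β))) (trans (Σ-*ˡ (f α) (λ β → ⟦ eqF α β ⟧ * g β)) (cong (f α *_) (pt g α))))
    where r : ∀ e a b → e * (a * b) ≡ a * (e * b)
          r = solve-∀

  prod3 : ∀ (f g h : Fin K → ℕ) → Σ³ (λ α β γ → f α * (g β * h γ)) ≡ Σᶠ f * (Σᶠ g * Σᶠ h)
  prod3 f g h = trans (Σ³-cong (λ α β γ → sym (*-assoc (f α) (g β) (h γ))))
    (trans (Σ³-last (λ α β → f α * g β) h) (trans (cong (_* Σᶠ h) (Σ²-prod f g)) (*-assoc (Σᶠ f) (Σᶠ g) (Σᶠ h))))

  L12 : ∀ (f g h : Fin K → ℕ) → Σ³ (λ α β γ → ⟦ eqF α β ⟧ * (f α * (g β * h γ))) ≡ Σᶠ (λ α → f α * g α) * Σᶠ h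
  L12 f g h = trans (Σ³-cong (λ α β γ → r ⟦ eqF α β ⟧ (f α) (g β) (h γ)))
    (trans (Σ³-last (λ α β → ⟦ eqF α β ⟧ * (f α * g β)) h) (cong (_* Σᶠ h) (Σ²-pt f g)))
    where r : ∀ e a b c → e * (a * (b * c)) ≡ (e * (a * b)) * c
          r = solve-∀

  L23 : ∀ (f g h : Fin K → ℕ) → Σ³ (λ α β γ → ⟦ eqF β γ ⟧ * (f α * (g β * h γ))) ≡ Σᶠ f * Σᶠ (λ β → g β * h β)
  L23 f g h = trans (Σ-cong (λ α → trans (Σ-cong (λ β → trans (Σ-cong (λ γ → r ⟦ eqF β γ ⟧ (f α) (g β) (h γ)))
                  (Σ-*ˡ (f α) (λ γ → ⟦ eqF β γ ⟧ * (g β * h γ)))))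
                (Σ-*ˡ (f α) (λ β → Σᶠ (λ γ → ⟦ eqF β γ ⟧ * (g β * h γ))))))
    (trans (Σ-*ʳ _ f) (cong (Σᶠ f *_) (Σ²-pt g h)))
    where r : ∀ e a b c → e * (a * (b * c)) ≡ a * (e * (b * c))
          r = solve-∀

  L13 : ∀ (f g h : Fin K → ℕ) → Σ³ (λ α β γ → ⟦ eqF α γ ⟧ * (f α * (g β * h γ))) ≡ Σᶠ (λ α → f α * h α) * Σᶠ g
  L13 f g h = trans (Σ-cong (λ α → Σ-swap (λ β γ → ⟦ eqF α γ ⟧ * (f α * (g β * h γ)))))
    (trans (Σ³-cong (λ α γ β → r ⟦ eqF α γ ⟧ (f α) (g β) (h γ)))
      (trans (Σ³-last (λ α γ → ⟦ eqF α γ ⟧ * (f α * h γ)) g) (cong (_* Σᶠ g) (Σ²-pt f h))))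
    where r : ∀ e a b c → e * (a * (b * c)) ≡ (e * (a * c)) * b
          r = solve-∀

  L123 : ∀ (f g h : Fin K → ℕ) → Σ³ (λ α β γ → ⟦ eqF α β ⟧ * (⟦ eqF α γ ⟧ * (f α * (g β * h γ)))) ≡ Σᶠ (λ α → f α * (g α * h α))
  L123 f g h = Σ-cong (λ α → begin
    Σᶠ (λ β → Σᶠ (λ γ → ⟦ eqF α β ⟧ * (⟦ eqF α γ ⟧ * (f α * (g β * h γ)))))
      ≡⟨ Σ-cong (λ β → trans (Σ-cong (λ γ → r ⟦ eqF α β ⟧ ⟦ eqF α γ ⟧ (f α) (g β) (h γ)))
            (trans (Σ-*ˡ (⟦ eqF α β ⟧ * (f α * g β)) (λ γ → ⟦ eqF α γ ⟧ * h γ)) (cong (⟦ eqF α β ⟧ * (f α * g β) *_) (pt h α)))) ⟩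
    Σᶠ (λ β → ⟦ eqF α β ⟧ * (f α * g β) * h α)
      ≡⟨ Σ-*ʳ (h α) (λ β → ⟦ eqF α β ⟧ * (f α * g β)) ⟩
    Σᶠ (λ β → ⟦ eqF α β ⟧ * (f α * g β)) * h α
      ≡⟨ cong (_* h α) (trans (Σ-cong (λ β → r2 ⟦ eqF α β ⟧ (f α) (g β))) (trans (Σ-*ˡ (f α) (λ β → ⟦ eqF α β ⟧ * g β)) (cong (f α *_) (pt g α)))) ⟩
    f α * g α * h α ≡⟨ *-assoc (f α) (g α) (h α) ⟩
    f α * (g α * h α) ∎)
    where r : ∀ e1 e2 a b c → e1 * (e2 * (a * (b * c))) ≡ (e1 * (a * b)) * (e2 * c)
          r = solve-∀
          r2 : ∀ e a b → e * (a * b) ≡ a * (e * b)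
          r2 = solve-∀

  coincide₁₂ : ∀ (a b c : Fin K) → (eqF a b ∧ eqF b c) ∧ not (eqF a c) ≡ false
  coincide₁₂ a b c with eqF a b in e1 | eqF b c in e2
  ... | false | _ = refl
  ... | true | false = refl
  ... | true | true rewrite eqF-true a b e1 | eqF-true b c e2 | eqF-refl c = refl

  coincide₁₃ : ∀ (a b c : Fin K) → (eqF a b ∧ eqF a c) ∧ not (eqF b c) ≡ false
  coincide₁₃ a b c with eqF a b in e1 | eqF a c in e2
  ... | false | _ = refl
  ... | true | false = refl
  ... | true | true rewrite sym (eqF-true a b e1) | sym (eqF-true a c e2) | eqF-refl a = refl

  coincide₂₃ : ∀ (a b c : Fin K) → (eqF b c ∧ eqF a c) ∧ not (eqF a b) ≡ false
  coincide₂₃ a b c with eqF b c in e1 | eqF a c in e2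
  ... | false | _ = refl
  ... | true | false = refl
  ... | true | true rewrite eqF-true b c e1 | eqF-true a c e2 | eqF-refl c = refl

  N₃ : Bool → Bool → Bool → Subset K → Subset K → Subset K → ℕ
  N₃ A B C s t u = Σ³ (λ α β γ → ⟦ (not (A ∧ eqF α β) ∧ (not (B ∧ eqF β γ) ∧ not (C ∧ eqF α γ))) ∧ (not (lookup s α) ∧ (not (lookup t β) ∧ not (lookup u γ))) ⟧)

  N₃-incl-excl : ∀ A B C (s t u : Subset K) →
    N₃ A B C s t u + (⟦ A ⟧ * (nAllowed₂ s t * nAllowed u) + ⟦ B ⟧ * (nAllowed s * nAllowed₂ t u) + ⟦ C ⟧ * (nAllowed₂ s u * nAllowed t)) + ⟦ A ∧ (B ∧ C) ⟧ * nAllowed₃ s t u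
    ≡ nAllowed s * (nAllowed t * nAllowed u) + (⟦ A ∧ B ⟧ * nAllowed₃ s t u + ⟦ B ∧ C ⟧ * nAllowed₃ s t u + ⟦ A ∧ C ⟧ * nAllowed₃ s t u)
  N₃-incl-excl A B C s t u = begin
    N₃ A B C s t u + (⟦ A ⟧ * (nAllowed₂ s t * nAllowed u) + ⟦ B ⟧ * (nAllowed s * nAllowed₂ t u) + ⟦ C ⟧ * (nAllowed₂ s u * nAllowed t)) + ⟦ A ∧ (B ∧ C) ⟧ * nAllowed₃ s t u
      ≡⟨ sym (cong₂ _+_ (cong₂ _+_ (refl {x = Σ³ X}) (cong₂ _+_ (cong₂ _+_ (trans (Σ³-*ˡ ⟦ A ⟧ (λ α β γ → ⟦ eqF α β ⟧ * Pn α β γ)) (cong (⟦ A ⟧ *_) (L12 p q w)))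
                                                              (trans (Σ³-*ˡ ⟦ B ⟧ (λ α β γ → ⟦ eqF β γ ⟧ * Pn α β γ)) (cong (⟦ B ⟧ *_) (L23 p q w))))
                                                   (trans (Σ³-*ˡ ⟦ C ⟧ (λ α β γ → ⟦ eqF α γ ⟧ * Pn α β γ)) (cong (⟦ C ⟧ *_) (L13 p q w)))))
                       (trans (Σ³-*ˡ ⟦ A ∧ (B ∧ C) ⟧ E13) (cong (⟦ A ∧ (B ∧ C) ⟧ *_) (L123 p q w)))) ⟩
    Σ³ X + (Σ³ (λ α β γ → ⟦ A ⟧ * (⟦ eqF α β ⟧ * Pn α β γ)) + Σ³ (λ α β γ → ⟦ B ⟧ * (⟦ eqF β γ ⟧ * Pn α β γ)) + Σ³ (λ α β γ → ⟦ C ⟧ * (⟦ eqF α γ ⟧ * Pn α β γ)))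
      + Σ³ (λ α β γ → ⟦ A ∧ (B ∧ C) ⟧ * E13 α β γ)
      ≡⟨ sym (trans (Σ³-+ {K} _ _) (cong (_+ Σ³ (λ α β γ → ⟦ A ∧ (B ∧ C) ⟧ * E13 α β γ)) (trans (Σ³-+ {K} _ _) (cong (Σ³ X +_)
             (trans (Σ³-+ {K} _ _) (cong (_+ Σ³ (λ α β γ → ⟦ C ⟧ * (⟦ eqF α γ ⟧ * Pn α β γ))) (Σ³-+ {K} _ _))))))) ⟩
    Σ³ (λ α β γ → X α β γ + (⟦ A ⟧ * (⟦ eqF α β ⟧ * Pn α β γ) + ⟦ B ⟧ * (⟦ eqF β γ ⟧ * Pn α β γ) + ⟦ C ⟧ * (⟦ eqF α γ ⟧ * Pn α β γ))
                   + ⟦ A ∧ (B ∧ C) ⟧ * E13 α β γ)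
      ≡⟨ Σ³-cong (λ α β γ → trans (cong (λ P → X α β γ + (⟦ A ⟧ * (⟦ eqF α β ⟧ * P) + ⟦ B ⟧ * (⟦ eqF β γ ⟧ * P) + ⟦ C ⟧ * (⟦ eqF α γ ⟧ * P))
                   + ⟦ A ∧ (B ∧ C) ⟧ * (⟦ eqF α β ⟧ * (⟦ eqF α γ ⟧ * P))) (sym (Pn≡ α β γ)))
             (trans (incl-excl₃-permitted A B C (eqF α β) (eqF β γ) (eqF α γ) (Pb α β γ) (coincide₁₂ α β γ) (coincide₁₃ α β γ) (coincide₂₃ α β γ))
               (cong (λ P → P + (⟦ A ∧ B ⟧ * (⟦ eqF α β ⟧ * (⟦ eqF α γ ⟧ * P)) + ⟦ B ∧ C ⟧ * (⟦ eqF α β ⟧ * (⟦ eqF α γ ⟧ * P)) + ⟦ A ∧ C ⟧ * (⟦ eqF α β ⟧ * (⟦ eqF α γ ⟧ * P)))) (Pn≡ α β γ)))) ⟩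
    Σ³ (λ α β γ → Pn α β γ + (⟦ A ∧ B ⟧ * E13 α β γ + ⟦ B ∧ C ⟧ * E13 α β γ + ⟦ A ∧ C ⟧ * E13 α β γ))
      ≡⟨ trans (Σ³-+ {K} _ _) (cong₂ _+_ (prod3 p q w) (trans (Σ³-+ {K} _ _) (cong₂ _+_ (trans (Σ³-+ {K} _ _)
            (cong₂ _+_ (trans (Σ³-*ˡ ⟦ A ∧ B ⟧ E13) (cong (⟦ A ∧ B ⟧ *_) (L123 p q w))) (trans (Σ³-*ˡ ⟦ B ∧ C ⟧ E13) (cong (⟦ B ∧ C ⟧ *_) (L123 p q w)))))
            (trans (Σ³-*ˡ ⟦ A ∧ C ⟧ E13) (cong (⟦ A ∧ C ⟧ *_) (L123 p q w)))))) ⟩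
    nAllowed s * (nAllowed t * nAllowed u) + (⟦ A ∧ B ⟧ * nAllowed₃ s t u + ⟦ B ∧ C ⟧ * nAllowed₃ s t u + ⟦ A ∧ C ⟧ * nAllowed₃ s t u) ∎
    where
    p q w : Fin K → ℕ
    p α = ⟦ not (lookup s α) ⟧
    q β = ⟦ not (lookup t β) ⟧
    w γ = ⟦ not (lookup u γ) ⟧
    Pb : Fin K → Fin K → Fin K → Bool
    Pb α β γ = not (lookup s α) ∧ (not (lookup t β) ∧ not (lookup u γ))
    Pn : Fin K → Fin K → Fin K → ℕ
    Pn α β γ = p α * (q β * w γ)
    Pn≡ : ∀ α β γ → ⟦ Pb α β γ ⟧ ≡ Pn α β γ
    Pn≡ α β γ = trans (⟦∧⟧ (not (lookup s α)) _) (cong (p α *_) (⟦∧⟧ (not (lookup t β)) _))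
    E13 : Fin K → Fin K → Fin K → ℕ
    E13 α β γ = ⟦ eqF α β ⟧ * (⟦ eqF α γ ⟧ * Pn α β γ)
    X : Fin K → Fin K → Fin K → ℕ
    X α β γ = ⟦ (not (A ∧ eqF α β) ∧ (not (B ∧ eqF β γ) ∧ not (C ∧ eqF α γ))) ∧ Pb α β γ ⟧

  N₂ : Bool → Subset K → Subset K → ℕ
  N₂ A s t = Σ² (λ α β → ⟦ not (A ∧ eqF α β) ∧ (not (lookup s α) ∧ not (lookup t β)) ⟧)

  incl-excl₂-permitted : ∀ A e P → ⟦ not (A ∧ e) ∧ P ⟧ + ⟦ A ⟧ * (⟦ e ⟧ * ⟦ P ⟧) ≡ ⟦ P ⟧
  incl-excl₂-permitted true true true = refl
  incl-excl₂-permitted true true false = refl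
  incl-excl₂-permitted true false true = refl
  incl-excl₂-permitted true false false = refl
  incl-excl₂-permitted false e true = refl
  incl-excl₂-permitted false e false = refl

  N₂-incl-excl : ∀ A (s t : Subset K) → N₂ A s t + ⟦ A ⟧ * nAllowed₂ s t ≡ nAllowed s * nAllowed t
  N₂-incl-excl A s t = begin
    N₂ A s t + ⟦ A ⟧ * nAllowed₂ s t
      ≡⟨ cong (N₂ A s t +_) (sym (trans (Σ²-*ˡ ⟦ A ⟧ (λ α β → ⟦ eqF α β ⟧ * (p α * q β))) (cong (⟦ A ⟧ *_) (Σ²-pt p q)))) ⟩
    N₂ A s t + Σ² (λ α β → ⟦ A ⟧ * (⟦ eqF α β ⟧ * (p α * q β)))
      ≡⟨ sym (Σ²-+ {K} _ _) ⟩
    Σ² (λ α β → ⟦ not (A ∧ eqF α β) ∧ (not (lookup s α) ∧ not (lookup t β)) ⟧ + ⟦ A ⟧ * (⟦ eqF α β ⟧ * (p α * q β)))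
      ≡⟨ Σ²-cong (λ α β → trans (cong (λ P → ⟦ not (A ∧ eqF α β) ∧ (not (lookup s α) ∧ not (lookup t β)) ⟧ + ⟦ A ⟧ * (⟦ eqF α β ⟧ * P))
                                   (sym (⟦∧⟧ (not (lookup s α)) (not (lookup t β)))))
                         (trans (incl-excl₂-permitted A (eqF α β) (not (lookup s α) ∧ not (lookup t β))) (⟦∧⟧ (not (lookup s α)) (not (lookup t β))))) ⟩
    Σ² (λ α β → p α * q β) ≡⟨ Σ²-prod p q ⟩
    nAllowed s * nAllowed t ∎
    where
    p q : Fin K → ℕ
    p α = ⟦ not (lookup s α) ⟧
    q β = ⟦ not (lookup t β) ⟧

balance₂ : ∀ n1 n2 a c1 c2 t K' i1 i2 W → n1 + a * c1 ≡ W → n2 + a * c2 ≡ W → c1 + t ≡ K' + i1 → c2 + t ≡ K' + i2 →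
  n1 + a * i1 ≡ n2 + a * i2
balance₂ n1 n2 a c1 c2 t K' i1 i2 W e1 e2 e3 e4 = +-cancelʳ-≡ (a * K') _ _ (trans (l n1 a c1 t K' i1 W e1 e3) (sym (l n2 a c2 t K' i2 W e2 e4)))
  where
  l : ∀ n a c t K' i W → n + a * c ≡ W → c + t ≡ K' + i → n + a * i + a * K' ≡ W + a * t
  l n a c t K' i W e e' = begin
    n + a * i + a * K' ≡⟨ r1 n a i K' ⟩
    n + a * (K' + i) ≡⟨ cong (λ z → n + a * z) (sym e') ⟩
    n + a * (c + t) ≡⟨ r2 n a c t ⟩
    (n + a * c) + a * t ≡⟨ cong (_+ a * t) e ⟩
    W + a * t ∎
    where
    r1 : ∀ n a i K' → n + a * i + a * K' ≡ n + a * (K' + i)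
    r1 = solve-∀
    r2 : ∀ n a c t → n + a * (c + t) ≡ (n + a * c) + a * t
    r2 = solve-∀

dominant-term-wins : ∀ y' h C M R H → suc y' ^ suc h ≤ suc y' * H + M * suc y' ^ h → suc y' * R ≤ C * suc y' ^ h → C + M ≤ y' → R < H
dominant-term-wins y' h C M R H eH eR big = *-cancelˡ-< y (R) H (≤-trans (s≤s eR) step)
  where
  y : ℕ
  y = suc y'
  Yh : ℕ
  Yh = y ^ h
  Yh≥1 : 1 ≤ Yh
  Yh≥1 = m^n>0 y h
  step : suc (C * Yh) ≤ y * H
  step = +-cancelʳ-≤ (M * Yh) _ _ (≤-trans s2 eH)
    where
    s1 : suc (C * Yh) + M * Yh ≤ (suc C + M) * Yh
    s1 = ≤-trans (+-monoˡ-≤ (C * Yh + M * Yh) Yh≥1) (≤-reflexive (r C M Yh))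
      where
      r : ∀ C M Y → Y + (C * Y + M * Y) ≡ (suc C + M) * Y
      r = solve-∀
    s2 : suc (C * Yh) + M * Yh ≤ y * Yh
    s2 = ≤-trans s1 (*-monoˡ-≤ Yh (s≤s big))

balance₃ : ∀ N1 N2 S W T1 T2 e2 e3 d Y1 Y2 → N1 + S + e3 * T1 ≡ W + e2 * T1 → N2 + S + e3 * T2 ≡ W + e2 * T2 →
  e2 ≡ e3 + d → d * T1 + Y2 ≡ d * T2 + Y1 → N1 + Y2 ≡ N2 + Y1
balance₃ N1 N2 S W T1 T2 e2 e3 d Y1 Y2 h1 h2 e h3 = +-cancelʳ-≡ S _ _ (begin
    N1 + Y2 + S ≡⟨ r1 N1 Y2 S ⟩
    (N1 + S) + Y2 ≡⟨ cong (_+ Y2) (st N1 S W T1 h1) ⟩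
    W + d * T1 + Y2 ≡⟨ trans (+-assoc W (d * T1) Y2) (trans (cong (W +_) h3) (sym (+-assoc W (d * T2) Y1))) ⟩
    W + d * T2 + Y1 ≡⟨ cong (_+ Y1) (sym (st N2 S W T2 h2)) ⟩
    (N2 + S) + Y1 ≡⟨ sym (r1 N2 Y1 S) ⟩
    N2 + Y1 + S ∎)
  where
  r1 : ∀ a b c → a + b + c ≡ (a + c) + b
  r1 = solve-∀
  st : ∀ N S W T → N + S + e3 * T ≡ W + e2 * T → N + S ≡ W + d * T
  st N S W T h = +-cancelʳ-≡ (e3 * T) _ _ (trans h (trans (cong (λ z → W + z * T) e) (r2 W e3 d T)))
    where r2 : ∀ W e3 d T → W + (e3 + d) * T ≡ W + d * T + e3 * T
          r2 = solve-∀

balance₃-defect : ∀ d T1 T2 k3 K I31 I32 J1 J2 Y1 Y2 → T1 + k3 + I31 ≡ K + J1 → T2 + k3 + I32 ≡ K + J2 →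
  d * I31 ≡ 0 → d * I32 ≡ 0 → d * J1 ≡ Y1 → d * J2 ≡ Y2 → d * T1 + Y2 ≡ d * T2 + Y1
balance₃-defect d T1 T2 k3 K I31 I32 J1 J2 Y1 Y2 h1 h2 z1 z2 y1 y2 = +-cancelʳ-≡ (d * k3) _ _ (begin
    d * T1 + Y2 + d * k3 ≡⟨ r1 d T1 Y2 k3 ⟩
    d * (T1 + k3) + Y2 ≡⟨ cong (_+ Y2) (st T1 k3 I31 J1 Y1 h1 z1 y1) ⟩
    d * K + Y1 + Y2 ≡⟨ r2 (d * K) Y1 Y2 ⟩
    d * K + Y2 + Y1 ≡⟨ cong (_+ Y1) (sym (st T2 k3 I32 J2 Y2 h2 z2 y2)) ⟩
    d * (T2 + k3) + Y1 ≡⟨ sym (r1 d T2 Y1 k3) ⟩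
    d * T2 + Y1 + d * k3 ∎)
  where
  r1 : ∀ d T Y k3 → d * T + Y + d * k3 ≡ d * (T + k3) + Y
  r1 = solve-∀
  r2 : ∀ a b c → a + b + c ≡ a + c + b
  r2 = solve-∀
  st : ∀ T k3 I3 J Y → T + k3 + I3 ≡ K + J → d * I3 ≡ 0 → d * J ≡ Y → d * (T + k3) ≡ d * K + Y
  st T k3 I3 J Y h z y = begin
    d * (T + k3) ≡⟨ sym (+-identityʳ _) ⟩
    d * (T + k3) + 0 ≡⟨ cong (d * (T + k3) +_) (sym z) ⟩
    d * (T + k3) + d * I3 ≡⟨ sym (*-distribˡ-+ d (T + k3) I3) ⟩
    d * (T + k3 + I3) ≡⟨ cong (d *_) h ⟩
    d * (K + J) ≡⟨ *-distribˡ-+ d K J ⟩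
    d * K + d * J ≡⟨ cong (d * K +_) y ⟩
    d * K + Y ∎

dominant-difference-wins : ∀ y' h C M X1 X2 U V R → suc y' ^ suc h * X1 ≤ suc y' * U + (M * suc y' ^ h) * X1 → V ≤ suc y' ^ h * X2 →
  suc y' * R ≤ C * suc y' ^ h → suc X2 ≤ X1 → C + M * X1 ≤ y' → R + V < U
dominant-difference-wins y' h C M X1 X2 U V R hU hV hR lt big = *-cancelˡ-< y (R + V) U (≤-trans (s≤s left) right)
  where
  y : ℕ
  y = suc y'
  Yh : ℕ
  Yh = y ^ h
  Yh≥1 : 1 ≤ Yh
  Yh≥1 = m^n>0 y h
  left : y * (R + V) ≤ C * Yh + y * Yh * X2
  left = ≤-trans (≤-reflexive (*-distribˡ-+ y R V)) (+-mono-≤ hR (≤-trans (*-monoʳ-≤ y hV) (≤-reflexive (sym (*-assoc y Yh X2)))))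
  -- Since X2 < X1:  y Yh X2 + (1 + C + M X1) Yh ≤ y Yh X2 + y Yh ≤ y Yh X1.
  step1 : y * Yh * X2 + (suc C + M * X1) * Yh ≤ y * Yh * X1
  step1 = ≤-trans (+-monoʳ-≤ (y * Yh * X2) (*-monoˡ-≤ Yh (s≤s big)))
            (≤-trans (≤-reflexive (e (y * Yh) X2)) (*-monoʳ-≤ (y * Yh) lt))
    where e : ∀ a x → a * x + a ≡ a * suc x
          e = solve-∀
  right : suc (C * Yh + y * Yh * X2) ≤ y * U
  right = +-cancelʳ-≤ (M * Yh * X1) _ _ (≤-trans s (≤-trans step1 hU))
    where
    s : suc (C * Yh + y * Yh * X2) + M * Yh * X1 ≤ y * Yh * X2 + (suc C + M * X1) * Yh
    s = ≤-trans (≤-reflexive (r C Yh y X2 M X1)) (≤-trans (+-monoˡ-≤ _ (+-monoˡ-≤ _ Yh≥1)) (≤-reflexive (r' C Yh y X2 M X1)))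
      where
      r : ∀ C Yh y X2 M X1 → suc (C * Yh + y * Yh * X2) + M * Yh * X1 ≡ 1 + C * Yh + (y * Yh * X2 + M * Yh * X1)
      r = solve-∀
      r' : ∀ C Yh y X2 M X1 → Yh + C * Yh + (y * Yh * X2 + M * Yh * X1) ≡ y * Yh * X2 + (suc C + M * X1) * Yh
      r' = solve-∀

module Expansion {n} (G : Graph n) (k y' : ℕ) where
  open LowHigh G k y'
  open HighCount G k y'
  open FewLow K
  open LowEval G k y'
  open ColourTuples K

  contribution₁ : ∀ r a → Σᶠ (λ α → lowWeight r (δ1 a α)) ≡ nAllowed (forb r a) * Hcount (mask₁ a)
  contribution₁ r a = trans (Σ-cong (λ α → cong₂ _*_ (cong ⟦_⟧ (SinglePattern.goodLow₁ a α r)) (Hcount-cong (lowMask₁ a α))))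
                  (Σ-*ʳ (Hcount (mask₁ a)) (λ α → ⟦ not (lookup (forb r a) α) ⟧))

  contribution₂ : ∀ r a b → ⟦ ltF a b ⟧ * Σᶠ (λ α → Σᶠ (λ β → lowWeight r (δ2 a α b β))) ≡
                  ⟦ ltF a b ⟧ * (N₂ (adj G a b) (forb r a) (forb r b) * Hcount (mask₂ a b))
  contribution₂ r a b with ltF a b in lab
  ... | false = refl
  ... | true = cong (_+ 0) (trans (Σ-cong (λ α → trans (Σ-cong (λ β → cong₂ _*_ (cong ⟦_⟧ (PairPattern.goodLow₂ a b α β lab r)) (Hcount-cong (lowMask₂ a α b β))))
                     (Σ-*ʳ (Hcount (mask₂ a b)) (λ β → ⟦ not (adj G a b ∧ eqF α β) ∧ (not (lookup (forb r a) α) ∧ not (lookup (forb r b) β)) ⟧))))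
                  (Σ-*ʳ (Hcount (mask₂ a b)) (λ α → Σᶠ (λ β → ⟦ not (adj G a b ∧ eqF α β) ∧ (not (lookup (forb r a) α) ∧ not (lookup (forb r b) β)) ⟧))))

  N₃r : Restraint n k → Fin n → Fin n → Fin n → ℕ
  N₃r r a b c = N₃ (adj G a b) (adj G b c) (adj G a c) (forb r a) (forb r b) (forb r c)

  contribution₃ : ∀ r a b c → ⟦ ltF a b ⟧ * (⟦ ltF b c ⟧ * Σ³ (λ α β γ → lowWeight r (δ3 a α b β c γ))) ≡
                    ⟦ ltF a b ⟧ * (⟦ ltF b c ⟧ * (N₃r r a b c * Hcount (mask₃ a b c)))
  contribution₃ r a b c with ltF a b in lab | ltF b c in lbc
  ... | false | _ = refl
  ... | true | false = refl
  ... | true | true = cong (λ t → (t + 0) + 0) (trans (Σ³-cong (λ α β γ → cong₂ _*_ (cong ⟦_⟧ (TriplePattern.goodLow₃ a b c α β γ lab lbc r)) (Hcount-cong (lowMask₃ a α b β c γ))))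
                  (Σ³-last3 _ (Hcount (mask₃ a b c))))
    where
    Σ³-last3 : ∀ (X : Fin K → Fin K → Fin K → ℕ) h → Σ³ (λ α β γ → X α β γ * h) ≡ Σ³ X * h
    Σ³-last3 X h = trans (Σ-cong (λ α → trans (Σ-cong (λ β → Σ-*ʳ h (X α β))) (Σ-*ʳ h (λ β → Σᶠ (X α β)))))
                         (Σ-*ʳ h (λ α → Σᶠ (λ β → Σᶠ (X α β))))

  split-by-nLow₂ : ∀ t x → x ≡ ⟦ t ≡ᵇ 0 ⟧ * x + ⟦ t ≡ᵇ 1 ⟧ * x + ⟦ t ≡ᵇ 2 ⟧ * x + ⟦ 2 <ᵇ t ⟧ * x
  split-by-nLow₂ zero x = sym (trans (+-identityʳ _) (trans (+-identityʳ _) (trans (+-identityʳ _) (+-identityʳ x))))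
  split-by-nLow₂ (suc zero) x = sym (trans (+-identityʳ _) (trans (+-identityʳ _) (+-identityʳ x)))
  split-by-nLow₂ (suc (suc zero)) x = sym (trans (+-identityʳ _) (+-identityʳ x))
  split-by-nLow₂ (suc (suc (suc t))) x = sym (+-identityʳ x)

  split-by-nLow₃ : ∀ t x → x ≡ ⟦ t ≡ᵇ 0 ⟧ * x + ⟦ t ≡ᵇ 1 ⟧ * x + ⟦ t ≡ᵇ 2 ⟧ * x + ⟦ t ≡ᵇ 3 ⟧ * x + ⟦ 3 <ᵇ t ⟧ * x
  split-by-nLow₃ zero x = sym (trans (+-identityʳ _) (trans (+-identityʳ _) (trans (+-identityʳ _) (trans (+-identityʳ _) (+-identityʳ x)))))
  split-by-nLow₃ (suc zero) x = sym (trans (+-identityʳ _) (trans (+-identityʳ _) (trans (+-identityʳ _) (+-identityʳ x))))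
  split-by-nLow₃ (suc (suc zero)) x = sym (trans (+-identityʳ _) (trans (+-identityʳ _) (+-identityʳ x)))
  split-by-nLow₃ (suc (suc (suc zero))) x = sym (trans (+-identityʳ _) (+-identityʳ x))
  split-by-nLow₃ (suc (suc (suc (suc t)))) x = sym (+-identityʳ x)

  Rest : ℕ → Restraint n k → ℕ
  Rest j r = ΣMaps n (suc K) (λ p → ⟦ j <ᵇ nLow p ⟧ * lowWeight r p)

  P1 : Restraint n k → ℕ
  P1 r = Σᶠ (λ a → nAllowed (forb r a) * Hcount (mask₁ a))

  P2 : Restraint n k → ℕ
  P2 r = Σᶠ (λ a → Σᶠ (λ b → ⟦ ltF a b ⟧ * (N₂ (adj G a b) (forb r a) (forb r b) * Hcount (mask₂ a b))))

  P3 : Restraint n k → ℕ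
  P3 r = Σᶠ (λ a → Σᶠ (λ b → Σᶠ (λ c → ⟦ ltF a b ⟧ * (⟦ ltF b c ⟧ * (N₃r r a b c * Hcount (mask₃ a b c))))))

  lowPart₀ : ∀ r → ΣMaps n (suc K) (λ p → ⟦ nLow p ≡ᵇ 0 ⟧ * lowWeight r p) ≡ lowWeight r (λ _ → zero)
  lowPart₀ r = ΣLow₀ n (lowWeight r) (lowWeight-ext r)

  lowPart₁ : ∀ r → ΣMaps n (suc K) (λ p → ⟦ nLow p ≡ᵇ 1 ⟧ * lowWeight r p) ≡ P1 r
  lowPart₁ r = trans (ΣLow₁ n (lowWeight r) (lowWeight-ext r)) (Σ-cong (contribution₁ r))

  lowPart₂ : ∀ r → ΣMaps n (suc K) (λ p → ⟦ nLow p ≡ᵇ 2 ⟧ * lowWeight r p) ≡ P2 r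
  lowPart₂ r = trans (ΣLow₂ n (lowWeight r) (lowWeight-ext r)) (Σ-cong (λ a → Σ-cong (λ b → contribution₂ r a b)))

  lowPart₃ : ∀ r → ΣMaps n (suc K) (λ p → ⟦ nLow p ≡ᵇ 3 ⟧ * lowWeight r p) ≡ P3 r
  lowPart₃ r = trans (ΣLow₃ n (lowWeight r) (lowWeight-ext r)) (Σ-cong (λ a → Σ-cong (λ b → Σ-cong (λ c → contribution₃ r a b c))))

  expansion₂ : ∀ r → πr G r (K + y) ≡ lowWeight r (λ _ → zero) + P1 r + P2 r + Rest 2 r
  expansion₂ r = begin
    πr G r (K + y) ≡⟨ π-as-lowSum r ⟩
    ΣMaps n (suc K) (lowWeight r) ≡⟨ ΣMaps-cong n (suc K) (λ p → split-by-nLow₂ (nLow p) (lowWeight r p)) ⟩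
    ΣMaps n (suc K) (λ p → ⟦ nLow p ≡ᵇ 0 ⟧ * lowWeight r p + ⟦ nLow p ≡ᵇ 1 ⟧ * lowWeight r p + ⟦ nLow p ≡ᵇ 2 ⟧ * lowWeight r p + ⟦ 2 <ᵇ nLow p ⟧ * lowWeight r p)
      ≡⟨ trans (ΣMaps-+ n (suc K) _ _) (cong (_+ Rest 2 r) (trans (ΣMaps-+ n (suc K) _ _) (cong (_+ ΣMaps n (suc K) (λ p → ⟦ nLow p ≡ᵇ 2 ⟧ * lowWeight r p)) (ΣMaps-+ n (suc K) _ _)))) ⟩
    ΣMaps n (suc K) (λ p → ⟦ nLow p ≡ᵇ 0 ⟧ * lowWeight r p) + ΣMaps n (suc K) (λ p → ⟦ nLow p ≡ᵇ 1 ⟧ * lowWeight r p) + ΣMaps n (suc K) (λ p → ⟦ nLow p ≡ᵇ 2 ⟧ * lowWeight r p) + Rest 2 r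
      ≡⟨ cong (_+ Rest 2 r) (cong₂ _+_ (cong₂ _+_ (lowPart₀ r) (lowPart₁ r)) (lowPart₂ r)) ⟩
    lowWeight r (λ _ → zero) + P1 r + P2 r + Rest 2 r ∎

  expansion₃ : ∀ r → πr G r (K + y) ≡ lowWeight r (λ _ → zero) + P1 r + P2 r + P3 r + Rest 3 r
  expansion₃ r = begin
    πr G r (K + y) ≡⟨ π-as-lowSum r ⟩
    ΣMaps n (suc K) (lowWeight r) ≡⟨ ΣMaps-cong n (suc K) (λ p → split-by-nLow₃ (nLow p) (lowWeight r p)) ⟩
    ΣMaps n (suc K) (λ p → ⟦ nLow p ≡ᵇ 0 ⟧ * lowWeight r p + ⟦ nLow p ≡ᵇ 1 ⟧ * lowWeight r p + ⟦ nLow p ≡ᵇ 2 ⟧ * lowWeight r p + ⟦ nLow p ≡ᵇ 3 ⟧ * lowWeight r p + ⟦ 3 <ᵇ nLow p ⟧ * lowWeight r p)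
      ≡⟨ trans (ΣMaps-+ n (suc K) _ _) (cong (_+ Rest 3 r) (trans (ΣMaps-+ n (suc K) _ _) (cong (_+ ΣMaps n (suc K) (λ p → ⟦ nLow p ≡ᵇ 3 ⟧ * lowWeight r p))
            (trans (ΣMaps-+ n (suc K) _ _) (cong (_+ ΣMaps n (suc K) (λ p → ⟦ nLow p ≡ᵇ 2 ⟧ * lowWeight r p)) (ΣMaps-+ n (suc K) _ _)))))) ⟩
    ΣMaps n (suc K) (λ p → ⟦ nLow p ≡ᵇ 0 ⟧ * lowWeight r p) + ΣMaps n (suc K) (λ p → ⟦ nLow p ≡ᵇ 1 ⟧ * lowWeight r p) + ΣMaps n (suc K) (λ p → ⟦ nLow p ≡ᵇ 2 ⟧ * lowWeight r p)
      + ΣMaps n (suc K) (λ p → ⟦ nLow p ≡ᵇ 3 ⟧ * lowWeight r p) + Rest 3 r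
      ≡⟨ cong (_+ Rest 3 r) (cong₂ _+_ (cong₂ _+_ (cong₂ _+_ (lowPart₀ r) (lowPart₁ r)) (lowPart₂ r)) (lowPart₃ r)) ⟩
    lowWeight r (λ _ → zero) + P1 r + P2 r + P3 r + Rest 3 r ∎

  <ᵇ-true : ∀ j t → (j <ᵇ t) ≡ true → suc j ≤ t
  <ᵇ-true j t e = <ᵇ⇒< j t (subst (λ b → Data.Bool.T b) (sym e) _)
    where open import Data.Bool using (T)

  Rest-pointwise : ∀ j r p → y ^ suc j * (⟦ j <ᵇ nLow p ⟧ * lowWeight r p) ≤ y ^ n
  Rest-pointwise j r p with j <ᵇ nLow p in e
  ... | false = ≤-trans (≤-reflexive (*-zeroʳ (y ^ suc j))) z≤n
  ... | true =
      ≤-trans (≤-reflexive (cong (y ^ suc j *_) (+-identityʳ _)))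
      (≤-trans (*-monoʳ-≤ (y ^ suc j) (≤-trans (a*b≤a' ⟦ goodLow r p ⟧ (Hcount (lowMask p)) (⟦≤1⟧ (goodLow r p))) (Hcount-upper (lowMask p))))
      (≤-trans (≤-reflexive (sym (^-distribˡ-+-* y (suc j) (nHigh (lowMask p)))))
         (^-monoʳ-≤ y (≤-trans (+-monoˡ-≤ (nHigh (lowMask p)) (<ᵇ-true j (nLow p) e)) (≤-reflexive (nLow+nHigh (lowMask p)))))))
    where
    a*b≤a' : ∀ a b → a ≤ 1 → a * b ≤ b
    a*b≤a' a b le = ≤-trans (*-monoˡ-≤ b le) (≤-reflexive (+-identityʳ b))

  Rest-bound : ∀ j r → y ^ suc j * Rest j r ≤ suc K ^ n * y ^ n
  Rest-bound j r = ≤-trans (≤-reflexive (sym (ΣMaps-*ˡ n (suc K) (y ^ suc j) (λ p → ⟦ j <ᵇ nLow p ⟧ * lowWeight r p))))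
                 (≤-trans (ΣMaps-mono n (suc K) (Rest-pointwise j r)) (≤-reflexive (ΣMaps-const n (suc K) (y ^ n))))

-- The zeroth and first order terms do not depend on the k-restraint, and the
-- second order term equals a restraint-independent quantity minus clashTerm, which
-- vanishes for proper restraints and is at least Hcount ≈ y ^ (n − 2) in case of a clash.
module PartI {n} (G : Graph n) (k y' : ℕ) where
  open LowHigh G k y'
  open HighCount G k y'
  open LowEval G k y'
  open ColourTuples K
  open Expansion G k y'

  I : Restraint n k → Fin n → Fin n → ℕ
  I r a b = ∣ forb r a ∩ forb r b ∣

  N₂r : Restraint n k → Fin n → Fin n → ℕ
  N₂r r a b = N₂ (adj G a b) (forb r a) (forb r b)

  nAllowed+k : ∀ r → IsKRestraint k r → ∀ v → nAllowed (forb r v) + k ≡ K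
  nAllowed+k r kr v = trans (cong (nAllowed (forb r v) +_) (sym (kr v))) (nAllowed+card (forb r v))

  nAllowed-eq : ∀ r r2 → IsKRestraint k r → IsKRestraint k r2 → ∀ v → nAllowed (forb r v) ≡ nAllowed (forb r2 v)
  nAllowed-eq r r2 kr kr2 v = +-cancelʳ-≡ k _ _ (trans (nAllowed+k r kr v) (sym (nAllowed+k r2 kr2 v)))

  P1-eq : ∀ r r2 → IsKRestraint k r → IsKRestraint k r2 → P1 r ≡ P1 r2
  P1-eq r r2 kr kr2 = Σ-cong (λ a → cong (_* Hcount (mask₁ a)) (nAllowed-eq r r2 kr kr2 a))

  nAllowed₂+2k : ∀ r → IsKRestraint k r → ∀ a b → nAllowed₂ (forb r a) (forb r b) + (k + k) ≡ K + I r a b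
  nAllowed₂+2k r kr a b = trans (sym (+-assoc (nAllowed₂ (forb r a) (forb r b)) k k))
    (trans (cong₂ (λ u v → nAllowed₂ (forb r a) (forb r b) + u + v) (sym (kr a)) (sym (kr b))) (nAllowed₂-incl-excl (forb r a) (forb r b)))

  pair-invariant : ∀ r r2 → IsKRestraint k r → IsKRestraint k r2 → ∀ a b →
    N₂r r a b + ⟦ adj G a b ⟧ * I r a b ≡ N₂r r2 a b + ⟦ adj G a b ⟧ * I r2 a b
  pair-invariant r r2 kr kr2 a b = balance₂ (N₂r r a b) (N₂r r2 a b) ⟦ adj G a b ⟧ (nAllowed₂ (forb r a) (forb r b)) (nAllowed₂ (forb r2 a) (forb r2 b))
    (k + k) K (I r a b) (I r2 a b) (nAllowed (forb r a) * nAllowed (forb r b))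
    (N₂-incl-excl (adj G a b) (forb r a) (forb r b))
    (trans (N₂-incl-excl (adj G a b) (forb r2 a) (forb r2 b)) (cong₂ _*_ (sym (nAllowed-eq r r2 kr kr2 a)) (sym (nAllowed-eq r r2 kr kr2 b))))
    (nAllowed₂+2k r kr a b) (nAllowed₂+2k r2 kr2 a b)

  clashTerm : Restraint n k → ℕ
  clashTerm r = Σᶠ (λ a → Σᶠ (λ b → ⟦ ltF a b ⟧ * ((⟦ adj G a b ⟧ * I r a b) * Hcount (mask₂ a b))))

  P2+clashTerm : ∀ r → P2 r + clashTerm r ≡ Σᶠ (λ a → Σᶠ (λ b → ⟦ ltF a b ⟧ * ((N₂r r a b + ⟦ adj G a b ⟧ * I r a b) * Hcount (mask₂ a b))))
  P2+clashTerm r = trans (sym (Σ-+ (λ a → Σᶠ (f a)) (λ a → Σᶠ (g a))))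
    (Σ-cong (λ a → trans (sym (Σ-+ (f a) (g a))) (Σ-cong (λ b → rr ⟦ ltF a b ⟧ (N₂r r a b) (⟦ adj G a b ⟧ * I r a b) (Hcount (mask₂ a b))))))
    where rr : ∀ l x z h → l * (x * h) + l * (z * h) ≡ l * ((x + z) * h)
          rr = solve-∀
          f g : Fin n → Fin n → ℕ
          f a b = ⟦ ltF a b ⟧ * (N₂r r a b * Hcount (mask₂ a b))
          g a b = ⟦ ltF a b ⟧ * ((⟦ adj G a b ⟧ * I r a b) * Hcount (mask₂ a b))

  P2+clashTerm-invariant : ∀ r r2 → IsKRestraint k r → IsKRestraint k r2 → P2 r + clashTerm r ≡ P2 r2 + clashTerm r2
  P2+clashTerm-invariant r r2 kr kr2 = trans (P2+clashTerm r) (trans (Σ-cong (λ a → Σ-cong (λ b → cong (λ t → ⟦ ltF a b ⟧ * (t * Hcount (mask₂ a b))) (pair-invariant r r2 kr kr2 a b)))) (sym (P2+clashTerm r2)))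

  clashTerm-proper : ∀ r → IsProperRestraint G r → clashTerm r ≡ 0
  clashTerm-proper r pr = Σ-zero (λ a → Σ-zero (λ b → z a b))
    where
    z : ∀ a b → ⟦ ltF a b ⟧ * ((⟦ adj G a b ⟧ * I r a b) * Hcount (mask₂ a b)) ≡ 0
    z a b with adj G a b in e
    ... | false = *-zeroʳ ⟦ ltF a b ⟧
    ... | true rewrite pr a b e = *-zeroʳ ⟦ ltF a b ⟧

  Rest-bound′ : ∀ j h r → j + h ≡ n → y * Rest j r ≤ suc K ^ n * y ^ h
  Rest-bound′ j h r e = *-cancelˡ-≤ (y ^ j) {{m^n≢0 y j}} (≤-trans (≤-reflexive l1) (≤-trans (Rest-bound j r) (≤-reflexive l2)))
    where
    l1 : y ^ j * (y * Rest j r) ≡ y ^ suc j * Rest j r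
    l1 = trans (sym (*-assoc (y ^ j) y (Rest j r))) (cong (_* Rest j r) (*-comm (y ^ j) y))
    l2 : suc K ^ n * y ^ n ≡ y ^ j * (suc K ^ n * y ^ h)
    l2 = trans (cong (λ t → suc K ^ n * y ^ t) (sym e)) (trans (cong (suc K ^ n *_) (^-distribˡ-+-* y j h))
           (trans (sym (*-assoc (suc K ^ n) (y ^ j) (y ^ h))) (trans (cong (_* y ^ h) (*-comm (suc K ^ n) (y ^ j))) (*-assoc (y ^ j) (suc K ^ n) (y ^ h)))))

  Hcount-lower′ : ∀ m → y ^ suc (nHigh m) ≤ y * Hcount m + (n * n) * y ^ nHigh m
  Hcount-lower′ m = ≤-trans (Hcount-lower m) (≤-reflexive (cong (y * Hcount m +_) (sym (*-assoc n n (y ^ nHigh m)))))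

  partI-ineq : ∀ rs r' → IsKRestraint k rs → IsKRestraint k r' → IsProperRestraint G r' →
    ∀ u0 v0 → ltF u0 v0 ≡ true → adj G u0 v0 ≡ true → 1 ≤ I rs u0 v0 → suc K ^ n + n * n ≤ y' →
    πr G rs (K + y) < πr G r' (K + y)
  partI-ineq rs r' krs kr' pr' u0 v0 lt ad I1 big =
    subst₂ _<_ (sym (expansion₂ rs)) (sym (expansion₂ r'))
      (≤-trans (+-monoʳ-< (lowWeight rs (λ _ → zero) + P1 rs + P2 rs) R<Q)
        (≤-trans (≤-reflexive eqQ) (m≤m+n _ (Rest 2 r'))))
    where
    t : Fin n → Bool
    t = mask₂ u0 v0
    h : ℕ
    h = nHigh t
    R<H : Rest 2 rs < Hcount t
    R<H = dominant-term-wins y' h (suc K ^ n) (n * n) (Rest 2 rs) (Hcount t) (Hcount-lower′ t) (Rest-bound′ 2 h rs (nHigh₂ u0 v0 lt)) big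
    H≤Q : Hcount t ≤ clashTerm rs
    H≤Q = ≤-trans term (≤-trans (Σ-term (λ b → ⟦ ltF u0 b ⟧ * ((⟦ adj G u0 b ⟧ * I rs u0 b) * Hcount (mask₂ u0 b))) v0)
                                   (Σ-term (λ a → Σᶠ (λ b → ⟦ ltF a b ⟧ * ((⟦ adj G a b ⟧ * I rs a b) * Hcount (mask₂ a b)))) u0))
      where
      term : Hcount t ≤ ⟦ ltF u0 v0 ⟧ * ((⟦ adj G u0 v0 ⟧ * I rs u0 v0) * Hcount t)
      term rewrite lt | ad = ≤-trans (m≤n*m (Hcount t) (I rs u0 v0) {{nz I1}}) (≤-reflexive (trans (cong (_* Hcount t) (sym (+-identityʳ (I rs u0 v0)))) (sym (+-identityʳ _))))
        where
        nz : ∀ {x} → 1 ≤ x → NonZero x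
        nz {suc x} _ = _
    R<Q : Rest 2 rs < clashTerm rs
    R<Q = <-≤-trans R<H H≤Q
    eqQ : lowWeight rs (λ _ → zero) + P1 rs + P2 rs + clashTerm rs ≡ lowWeight r' (λ _ → zero) + P1 r' + P2 r'
    eqQ = trans (+-assoc (lowWeight rs (λ _ → zero) + P1 rs) (P2 rs) (clashTerm rs))
          (trans (cong₂ (λ u v → lowWeight rs (λ _ → zero) + u + v) (P1-eq rs r' krs kr')
                    (trans (P2+clashTerm-invariant rs r' krs kr') (trans (cong (P2 r' +_) (clashTerm-proper r' pr')) (+-identityʳ (P2 r')))))
                 refl)

  clash-loses : ∀ rs r' → IsKRestraint k rs → IsKRestraint k r' → IsProperRestraint G r' →
    ∀ u v → adj G u v ≡ true → 1 ≤ I rs u v → suc K ^ n + n * n ≤ y' → πr G rs (K + y) < πr G r' (K + y)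
  clash-loses rs r' krs kr' pr' u v uv clash big with ltF u v in u<v
  ... | true = partI-ineq rs r' krs kr' pr' u v u<v uv clash big
  ... | false = partI-ineq rs r' krs kr' pr' v u (ltF-total u v (adj-distinct G uv) u<v) (trans (gsym G v u) uv)
                  (subst (1 ≤_) (∩-comm-card (forb rs u) (forb rs v)) clash) big

⟦⟧0 : ∀ b → ⟦ b ⟧ ≡ 0 → b ≡ false
⟦⟧0 false _ = refl

nCommon₃-zero : ∀ {m} (s t u : Subset m) → (∀ α → (lookup s α ∧ (lookup t α ∧ lookup u α)) ≡ false) → nCommon₃ s t u ≡ 0
nCommon₃-zero s t u h = Σ-zero (λ α → cong ⟦_⟧ (h α))

nCommon₃-ab : ∀ {m} (s t u : Subset m) → ∣ s ∩ t ∣ ≡ 0 → nCommon₃ s t u ≡ 0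
nCommon₃-ab s t u e = nCommon₃-zero s t u (λ α → f (lookup s α) (lookup t α) (lookup u α) (⟦⟧0 _ (Σ-zero-inv _ (trans (sym (card∩ s t)) e) α)))
  where f : ∀ a b c → a ∧ b ≡ false → a ∧ (b ∧ c) ≡ false
        f true true c ()
        f true false c _ = refl
        f false b c _ = refl

nCommon₃-bc : ∀ {m} (s t u : Subset m) → ∣ t ∩ u ∣ ≡ 0 → nCommon₃ s t u ≡ 0
nCommon₃-bc s t u e = nCommon₃-zero s t u (λ α → f (lookup s α) (lookup t α) (lookup u α) (⟦⟧0 _ (Σ-zero-inv _ (trans (sym (card∩ t u)) e) α)))
  where f : ∀ a b c → b ∧ c ≡ false → a ∧ (b ∧ c) ≡ false
        f true b c e = e
        f false b c _ = refl

-- For a triple a < b < c,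
-- N₃ + Y is the same for all proper k-restraints, where Y counts the clashes
-- ∣r(v) ∩ r(w)∣ along paths v − u − w inside the triple; this is the source of A₇''.
module TripleBalance {n} (G : Graph n) (k y' : ℕ) where
  open LowHigh G k y'
  open ColourTuples K
  open PartI G k y'

  Y : Bool → Bool → Bool → Restraint n k → Fin n → Fin n → Fin n → ℕ
  Y A B C r a b c = ⟦ A ⟧ * (⟦ C ⟧ * I r b c) + ⟦ A ⟧ * (⟦ B ⟧ * I r a c) + ⟦ C ⟧ * (⟦ B ⟧ * I r a b)

  S₁ : Bool → Bool → Bool → Restraint n k → Fin n → Fin n → Fin n → ℕ
  S₁ A B C r a b c = ⟦ A ⟧ * (nAllowed₂ (forb r a) (forb r b) * nAllowed (forb r c)) + ⟦ B ⟧ * (nAllowed (forb r a) * nAllowed₂ (forb r b) (forb r c))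
                     + ⟦ C ⟧ * (nAllowed₂ (forb r a) (forb r c) * nAllowed (forb r b))

  module _ (r rs : Restraint n k) (kr : IsKRestraint k r) (krs : IsKRestraint k rs)
           (pr : IsProperRestraint G r) (prs : IsProperRestraint G rs) (a b c : Fin n) where

    nAllowed₂-edge-eq : ∀ u v → adj G u v ≡ true → nAllowed₂ (forb r u) (forb r v) ≡ nAllowed₂ (forb rs u) (forb rs v)
    nAllowed₂-edge-eq u v e = +-cancelʳ-≡ (k + k) _ _ (trans (nAllowed₂+2k r kr u v) (trans (cong (K +_) (trans (pr u v e) (sym (prs u v e)))) (sym (nAllowed₂+2k rs krs u v))))

    wq : ∀ v → nAllowed (forb r v) ≡ nAllowed (forb rs v)
    wq = nAllowed-eq r rs kr krs

    termEq : ∀ (A : Bool) {x x' w w'} → (A ≡ true → x ≡ x') → (A ≡ true → w ≡ w') → ⟦ A ⟧ * (x * w) ≡ ⟦ A ⟧ * (x' * w')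
    termEq true h e = cong (λ z → 1 * z) (cong₂ _*_ (h refl) (e refl))
    termEq false h e = refl

    S₁-eq : ∀ A B C → adj G a b ≡ A → adj G b c ≡ B → adj G a c ≡ C → S₁ A B C r a b c ≡ S₁ A B C rs a b c
    S₁-eq A B C eA eB eC = cong₂ _+_ (cong₂ _+_ (termEq A (λ t → nAllowed₂-edge-eq a b (trans eA t)) (λ _ → wq c))
                                              (termEq B (λ _ → wq a) (λ t → nAllowed₂-edge-eq b c (trans eB t))))
                                   (termEq C (λ t → nAllowed₂-edge-eq a c (trans eC t)) (λ _ → wq b))

    nPaths : Bool → Bool → Bool → ℕ
    nPaths true true true = 2
    nPaths true false true = 1
    nPaths true true false = 1
    nPaths false true true = 1
    nPaths _ _ _ = 0

    clashSum : Restraint n k → ℕ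
    clashSum q = I q a b + I q b c + I q a c

    nCommon₃q : Restraint n k → ℕ
    nCommon₃q q = nCommon₃ (forb q a) (forb q b) (forb q c)

    proper-triple-facts : ∀ A B C → adj G a b ≡ A → adj G b c ≡ B → adj G a c ≡ C → ∀ q → IsProperRestraint G q →
      (nPaths A B C * nCommon₃q q ≡ 0) × (nPaths A B C * clashSum q ≡ Y A B C q a b c)
    proper-triple-facts true true true eA eB eC q pq rewrite nCommon₃-ab (forb q a) (forb q b) (forb q c) (pq a b eA) | pq a b eA | pq b c eB | pq a c eC = refl , refl
    proper-triple-facts true false true eA eB eC q pq rewrite nCommon₃-ab (forb q a) (forb q b) (forb q c) (pq a b eA) | pq a b eA | pq a c eC = refl , rr (I q b c)
      where rr : ∀ x → 1 * (0 + x + 0) ≡ 1 * (1 * x) + 1 * (0 * 0) + 1 * (0 * 0)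
            rr = solve-∀
    proper-triple-facts true true false eA eB eC q pq rewrite nCommon₃-ab (forb q a) (forb q b) (forb q c) (pq a b eA) | pq a b eA | pq b c eB = refl , rr (I q a c)
      where rr : ∀ x → 1 * (0 + 0 + x) ≡ 1 * (0 * 0) + 1 * (1 * x) + 0 * (1 * 0)
            rr = solve-∀
    proper-triple-facts false true true eA eB eC q pq rewrite nCommon₃-bc (forb q a) (forb q b) (forb q c) (pq b c eB) | pq b c eB | pq a c eC = refl , rr (I q a b)
      where rr : ∀ x → 1 * (x + 0 + 0) ≡ 0 * (1 * 0) + 0 * (1 * 0) + 1 * (1 * x)
            rr = solve-∀
    proper-triple-facts true false false eA eB eC q pq = refl , refl
    proper-triple-facts false true false eA eB eC q pq = refl , refl
    proper-triple-facts false false true eA eB eC q pq = refl , refl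
    proper-triple-facts false false false eA eB eC q pq = refl , refl

    nEdgePairs : Bool → Bool → Bool → ℕ
    nEdgePairs A B C = ⟦ A ∧ B ⟧ + ⟦ B ∧ C ⟧ + ⟦ A ∧ C ⟧

    edgePairs-split : ∀ A B C → nEdgePairs A B C ≡ ⟦ A ∧ (B ∧ C) ⟧ + nPaths A B C
    edgePairs-split true true true = refl
    edgePairs-split true false true = refl
    edgePairs-split true true false = refl
    edgePairs-split false true true = refl
    edgePairs-split true false false = refl
    edgePairs-split false true false = refl
    edgePairs-split false false true = refl
    edgePairs-split false false false = refl

    N₃q : Bool → Bool → Bool → Restraint n k → ℕ
    N₃q A B C q = N₃ A B C (forb q a) (forb q b) (forb q c)

    nAllowed₃q : Restraint n k → ℕ
    nAllowed₃q q = nAllowed₃ (forb q a) (forb q b) (forb q c)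

    allowedProduct : Restraint n k → ℕ
    allowedProduct q = nAllowed (forb q a) * (nAllowed (forb q b) * nAllowed (forb q c))

    N₃-relation : ∀ A B C q → N₃q A B C q + S₁ A B C q a b c + ⟦ A ∧ (B ∧ C) ⟧ * nAllowed₃q q ≡ allowedProduct q + nEdgePairs A B C * nAllowed₃q q
    N₃-relation A B C q = trans (N₃-incl-excl A B C (forb q a) (forb q b) (forb q c)) (cong (allowedProduct q +_) (rr ⟦ A ∧ B ⟧ ⟦ B ∧ C ⟧ ⟦ A ∧ C ⟧ (nAllowed₃q q)))
      where rr : ∀ x y z T → x * T + y * T + z * T ≡ (x + y + z) * T
            rr = solve-∀

    nAllowed₃-relation : ∀ q → IsKRestraint k q → nAllowed₃q q + (k + k + k) + nCommon₃q q ≡ K + clashSum q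
    nAllowed₃-relation q kq = trans (cong (λ z → nAllowed₃q q + z + nCommon₃q q) (cong₂ _+_ (cong₂ _+_ (sym (kq a)) (sym (kq b))) (sym (kq c))))
                       (nAllowed₃-incl-excl (forb q a) (forb q b) (forb q c))

    triple-balance : ∀ A B C → adj G a b ≡ A → adj G b c ≡ B → adj G a c ≡ C →
      N₃q A B C r + Y A B C rs a b c ≡ N₃q A B C rs + Y A B C r a b c
    triple-balance A B C eA eB eC = balance₃ (N₃q A B C r) (N₃q A B C rs) (S₁ A B C rs a b c) (allowedProduct r) (nAllowed₃q r) (nAllowed₃q rs)
      (nEdgePairs A B C) ⟦ A ∧ (B ∧ C) ⟧ (nPaths A B C) (Y A B C r a b c) (Y A B C rs a b c)
      (trans (cong (λ s → N₃q A B C r + s + ⟦ A ∧ (B ∧ C) ⟧ * nAllowed₃q r) (sym (S₁-eq A B C eA eB eC))) (N₃-relation A B C r))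
      (trans (N₃-relation A B C rs) (cong (_+ nEdgePairs A B C * nAllowed₃q rs) (sym (cong₂ _*_ (wq a) (cong₂ _*_ (wq b) (wq c))))))
      (edgePairs-split A B C)
      (balance₃-defect (nPaths A B C) (nAllowed₃q r) (nAllowed₃q rs) (k + k + k) K (nCommon₃q r) (nCommon₃q rs) (clashSum r) (clashSum rs) (Y A B C r a b c) (Y A B C rs a b c)
         (nAllowed₃-relation r kr) (nAllowed₃-relation rs krs)
         (proj₁ (proper-triple-facts A B C eA eB eC r pr)) (proj₁ (proper-triple-facts A B C eA eB eC rs prs))
         (proj₂ (proper-triple-facts A B C eA eB eC r pr)) (proj₂ (proper-triple-facts A B C eA eB eC rs prs)))

order₃ : ∀ x y z → ¬ x ≡ y → ¬ x ≡ z → ⟦ y <ᵇ z ⟧ ≡ ⟦ x <ᵇ y ⟧ * ⟦ y <ᵇ z ⟧ + ⟦ y <ᵇ x ⟧ * ⟦ x <ᵇ z ⟧ + ⟦ y <ᵇ z ⟧ * ⟦ z <ᵇ x ⟧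
order₃ zero zero z n1 n2 = ⊥-elim (n1 refl)
order₃ zero (suc y) zero n1 n2 = ⊥-elim (n2 refl)
order₃ zero (suc y) (suc z) n1 n2 = rr ⟦ y <ᵇ z ⟧
  where rr : ∀ b → b ≡ 1 * b + 0 * 1 + b * 0
        rr = solve-∀
order₃ (suc x) zero zero n1 n2 = refl
order₃ (suc x) zero (suc z) n1 n2 = trans (sym (tri2 x z (λ e → n2 (cong suc e)))) (rr ⟦ x <ᵇ z ⟧ ⟦ z <ᵇ x ⟧)
  where rr : ∀ a b → a + b ≡ 0 * 1 + 1 * a + 1 * b
        rr = solve-∀
order₃ (suc x) (suc y) zero n1 n2 = sym (rr ⟦ x <ᵇ y ⟧ ⟦ y <ᵇ x ⟧)
  where rr : ∀ a b → a * 0 + b * 0 + 0 * 1 ≡ 0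
        rr = solve-∀
order₃ (suc x) (suc y) (suc z) n1 n2 = order₃ x y z (λ e → n1 (cong suc e)) (λ e → n2 (cong suc e))

module A7Reorder {n} (G : Graph n) (I : Fin n → Fin n → ℕ) where
  g : Fin n → Fin n → Fin n → ℕ
  g u v w = ⟦ adj G u v ⟧ * (⟦ adj G u w ⟧ * I v w)

  negSum : ℕ
  negSum = Σᶠ (λ u → Σᶠ (λ v → Σᶠ (λ w → if adj G u v ∧ adj G u w ∧ (toℕ v <ᵇ toℕ w) then I v w else 0)))

  ordered-pair-term : ∀ u v w → (if adj G u v ∧ adj G u w ∧ (toℕ v <ᵇ toℕ w) then I v w else 0) ≡ ⟦ ltF v w ⟧ * g u v w
  ordered-pair-term u v w with adj G u v | adj G u w | toℕ v <ᵇ toℕ w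
  ... | true | true | true = sym (trans (+-identityʳ _) (trans (+-identityʳ _) (+-identityʳ _)))
  ... | true | true | false = refl
  ... | true | false | true = sym (+-identityʳ _)
  ... | true | false | false = refl
  ... | false | b | c = sym (*-zeroʳ ⟦ c ⟧)

  path-degenerate₁ : ∀ u w → g u u w ≡ 0
  path-degenerate₁ u w rewrite irrefl G u = refl
  path-degenerate₂ : ∀ u v → g u v u ≡ 0
  path-degenerate₂ u v rewrite irrefl G u = *-zeroʳ ⟦ adj G u v ⟧

  -- Each path v − u − w with v < w is counted at exactly one increasing triple.
  order-split : ∀ u v w → ⟦ ltF v w ⟧ * g u v w ≡ ⟦ ltF u v ⟧ * (⟦ ltF v w ⟧ * g u v w) + ⟦ ltF v u ⟧ * (⟦ ltF u w ⟧ * g u v w) + ⟦ ltF v w ⟧ * (⟦ ltF w u ⟧ * g u v w)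
  order-split u v w with toℕ u ≟ toℕ v
  ... | yes e rewrite toℕ-injective e | path-degenerate₁ v w = rz ⟦ ltF v w ⟧ ⟦ ltF v v ⟧ ⟦ ltF w v ⟧
    where rz : ∀ a b c → a * 0 ≡ b * (a * 0) + b * (a * 0) + a * (c * 0)
          rz = solve-∀
  ... | no ne with toℕ u ≟ toℕ w
  ... | yes e rewrite toℕ-injective e | path-degenerate₂ w v = rz ⟦ ltF v w ⟧ ⟦ ltF w v ⟧ ⟦ ltF w w ⟧
    where rz : ∀ a b c → a * 0 ≡ b * (a * 0) + a * (c * 0) + a * (c * 0)
          rz = solve-∀
  ... | no ne2 = trans (cong (_* g u v w) (order₃ (toℕ u) (toℕ v) (toℕ w) ne ne2)) (rr ⟦ ltF u v ⟧ ⟦ ltF v w ⟧ ⟦ ltF v u ⟧ ⟦ ltF u w ⟧ ⟦ ltF w u ⟧ (g u v w))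
    where rr : ∀ a b c d e G → (a * b + c * d + b * e) * G ≡ a * (b * G) + c * (d * G) + b * (e * G)
          rr = solve-∀

  negSum-by-triples : negSum ≡ Σ³ (λ a b c → ⟦ ltF a b ⟧ * (⟦ ltF b c ⟧ * (g a b c + g b a c + g c a b)))
  negSum-by-triples = begin
    negSum ≡⟨ Σ³-cong ordered-pair-term ⟩
    Σ³ (λ u v w → ⟦ ltF v w ⟧ * g u v w) ≡⟨ Σ³-cong order-split ⟩
    Σ³ (λ u v w → T1 u v w + T2 u v w + T3 u v w) ≡⟨ trans (Σ³-+ (λ u v w → T1 u v w + T2 u v w) T3) (cong (_+ Σ³ T3) (Σ³-+ T1 T2)) ⟩
    Σ³ T1 + Σ³ T2 + Σ³ T3 ≡⟨ cong₂ _+_ (cong (Σ³ T1 +_) e2) e3 ⟩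
    Σ³ (λ a b c → ⟦ ltF a b ⟧ * (⟦ ltF b c ⟧ * g a b c)) + Σ³ (λ a b c → ⟦ ltF a b ⟧ * (⟦ ltF b c ⟧ * g b a c))
      + Σ³ (λ a b c → ⟦ ltF a b ⟧ * (⟦ ltF b c ⟧ * g c a b))
      ≡⟨ sym (trans (Σ³-+ (λ a b c → X1 a b c + X2 a b c) X3) (cong (_+ Σ³ X3) (Σ³-+ X1 X2))) ⟩
    Σ³ (λ a b c → ⟦ ltF a b ⟧ * (⟦ ltF b c ⟧ * g a b c) + ⟦ ltF a b ⟧ * (⟦ ltF b c ⟧ * g b a c) + ⟦ ltF a b ⟧ * (⟦ ltF b c ⟧ * g c a b))
      ≡⟨ Σ³-cong (λ a b c → rr ⟦ ltF a b ⟧ ⟦ ltF b c ⟧ (g a b c) (g b a c) (g c a b)) ⟩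
    Σ³ (λ a b c → ⟦ ltF a b ⟧ * (⟦ ltF b c ⟧ * (g a b c + g b a c + g c a b))) ∎
    where
    open ≡-Reasoning
    X1 X2 X3 : Fin n → Fin n → Fin n → ℕ
    X1 a b c = ⟦ ltF a b ⟧ * (⟦ ltF b c ⟧ * g a b c)
    X2 a b c = ⟦ ltF a b ⟧ * (⟦ ltF b c ⟧ * g b a c)
    X3 a b c = ⟦ ltF a b ⟧ * (⟦ ltF b c ⟧ * g c a b)
    T1 T2 T3 : Fin n → Fin n → Fin n → ℕ
    T1 u v w = ⟦ ltF u v ⟧ * (⟦ ltF v w ⟧ * g u v w)
    T2 u v w = ⟦ ltF v u ⟧ * (⟦ ltF u w ⟧ * g u v w)
    T3 u v w = ⟦ ltF v w ⟧ * (⟦ ltF w u ⟧ * g u v w)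
    rr : ∀ p q x y z → p * (q * x) + p * (q * y) + p * (q * z) ≡ p * (q * (x + y + z))
    rr = solve-∀
    e2 : Σ³ T2 ≡ Σ³ (λ a b c → ⟦ ltF a b ⟧ * (⟦ ltF b c ⟧ * g b a c))
    e2 = Σ-swap (λ u v → Σᶠ (λ w → T2 u v w))
    e3 : Σ³ T3 ≡ Σ³ (λ a b c → ⟦ ltF a b ⟧ * (⟦ ltF b c ⟧ * g c a b))
    e3 = trans (Σ-swap (λ u v → Σᶠ (λ w → T3 u v w))) (Σ-cong (λ v → Σ-swap (λ u w → T3 u v w)))

*-pos : ∀ a b → 0 < a * b → 0 < b
*-pos a zero lt rewrite *-zeroʳ a = lt
*-pos a (suc b) lt = s≤s z≤n

⟦⟧-pos : ∀ b x → 0 < ⟦ b ⟧ * x → b ≡ true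
⟦⟧-pos true x _ = refl
⟦⟧-pos false x ()

-- Part (ii): among proper k-restraints the third order term decides, and it equals a
-- restraint-independent quantity minus Ut, with Ut ≈ y ^ (n − 3) · (−A₇'').
module PartII {n} (G : Graph n) (k y' : ℕ) where
  open LowHigh G k y'
  open HighCount G k y'
  open LowEval G k y'
  open Expansion G k y'
  open PartI G k y'
  open TripleBalance G k y'

  Yt : Restraint n k → Fin n → Fin n → Fin n → ℕ
  Yt q a b c = Y (adj G a b) (adj G b c) (adj G a c) q a b c

  Xt : Restraint n k → ℕ
  Xt q = Σ³ (λ a b c → ⟦ ltF a b ⟧ * (⟦ ltF b c ⟧ * Yt q a b c))

  negX : ∀ q → negA7'' G q ≡ Xt q
  negX q = trans (A7Reorder.negSum-by-triples G (I q)) (Σ³-cong (λ a b c → cong (λ t → ⟦ ltF a b ⟧ * (⟦ ltF b c ⟧ * t)) (gY a b c)))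
    where
    gY : ∀ a b c → A7Reorder.g G (I q) a b c + A7Reorder.g G (I q) b a c + A7Reorder.g G (I q) c a b ≡ Yt q a b c
    gY a b c = cong₂ _+_ (cong (A7Reorder.g G (I q) a b c +_) (cong (λ t → ⟦ t ⟧ * (⟦ adj G b c ⟧ * I q a c)) (gsym G b a)))
                         (cong₂ (λ s t → ⟦ s ⟧ * (⟦ t ⟧ * I q a b)) (gsym G c a) (gsym G c b))

  Ut : Restraint n k → ℕ
  Ut q = Σ³ (λ a b c → ⟦ ltF a b ⟧ * (⟦ ltF b c ⟧ * (Yt q a b c * Hcount (mask₃ a b c))))

  P3+Ut-invariant : ∀ r rs → IsKRestraint k r → IsKRestraint k rs → IsProperRestraint G r → IsProperRestraint G rs →
    P3 r + Ut rs ≡ P3 rs + Ut r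
  P3+Ut-invariant r rs kr krs pr prs = trans (sym (Σ³-+ {n} _ _)) (trans (Σ³-cong ptw) (Σ³-+ {n} _ _))
    where
    rr : ∀ l1 l2 N Y H → l1 * (l2 * (N * H)) + l1 * (l2 * (Y * H)) ≡ l1 * (l2 * ((N + Y) * H))
    rr = solve-∀
    ptw : ∀ a b c → ⟦ ltF a b ⟧ * (⟦ ltF b c ⟧ * (N₃r r a b c * Hcount (mask₃ a b c))) + ⟦ ltF a b ⟧ * (⟦ ltF b c ⟧ * (Yt rs a b c * Hcount (mask₃ a b c)))
                 ≡ ⟦ ltF a b ⟧ * (⟦ ltF b c ⟧ * (N₃r rs a b c * Hcount (mask₃ a b c))) + ⟦ ltF a b ⟧ * (⟦ ltF b c ⟧ * (Yt r a b c * Hcount (mask₃ a b c)))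
    ptw a b c = trans (rr ⟦ ltF a b ⟧ ⟦ ltF b c ⟧ (N₃r r a b c) (Yt rs a b c) (Hcount (mask₃ a b c)))
      (trans (cong (λ t → ⟦ ltF a b ⟧ * (⟦ ltF b c ⟧ * (t * Hcount (mask₃ a b c))))
                (triple-balance r rs kr krs pr prs a b c (adj G a b) (adj G b c) (adj G a c) refl refl refl))
        (sym (rr ⟦ ltF a b ⟧ ⟦ ltF b c ⟧ (N₃r rs a b c) (Yt r a b c) (Hcount (mask₃ a b c)))))

  module _ (h : ℕ) (nh : 3 + h ≡ n) where
    nHigh-triple : ∀ a b c → ltF a b ≡ true → ltF b c ≡ true → nHigh (mask₃ a b c) ≡ h
    nHigh-triple a b c l1 l2 = +-cancelˡ-≡ 3 _ _ (trans (nHigh₃ a b c l1 l2) (sym nh))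

    Ut-lower-pointwise : ∀ q a b c → y ^ suc h * (⟦ ltF a b ⟧ * (⟦ ltF b c ⟧ * Yt q a b c)) ≤
                       y * (⟦ ltF a b ⟧ * (⟦ ltF b c ⟧ * (Yt q a b c * Hcount (mask₃ a b c)))) + (n * n * y ^ h) * (⟦ ltF a b ⟧ * (⟦ ltF b c ⟧ * Yt q a b c))
    Ut-lower-pointwise q a b c with ltF a b in e1 | ltF b c in e2
    ... | false | _ = ≤-trans (≤-reflexive (*-zeroʳ (y ^ suc h))) z≤n
    ... | true | false = ≤-trans (≤-reflexive (*-zeroʳ (y ^ suc h))) z≤n
    ... | true | true = ≤-trans (≤-reflexive (r1 (y ^ suc h) (Yt q a b c)))
          (≤-trans (*-monoˡ-≤ (Yt q a b c) HL2) (≤-reflexive (r2 y (Hcount (mask₃ a b c)) (n * n * y ^ h) (Yt q a b c))))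
      where
      HL2 : y ^ suc h ≤ y * Hcount (mask₃ a b c) + n * n * y ^ h
      HL2 = subst (λ t → y ^ suc t ≤ y * Hcount (mask₃ a b c) + n * n * y ^ t) (nHigh-triple a b c e1 e2) (Hcount-lower′ (mask₃ a b c))
      r1 : ∀ A Y → A * (1 * (1 * Y)) ≡ A * Y
      r1 = solve-∀
      r2 : ∀ y H M Y → (y * H + M) * Y ≡ y * (1 * (1 * (Y * H))) + M * (1 * (1 * Y))
      r2 = solve-∀

    Ut-lower : ∀ q → y ^ suc h * Xt q ≤ y * Ut q + (n * n * y ^ h) * Xt q
    Ut-lower q = ≤-trans (≤-reflexive (sym (Σ³-*ˡ {n} (y ^ suc h) _)))
            (≤-trans (Σ³-mono (Ut-lower-pointwise q))
              (≤-reflexive (trans (Σ³-+ {n} _ _) (cong₂ _+_ (Σ³-*ˡ {n} y _) (Σ³-*ˡ {n} (n * n * y ^ h) _)))))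

    Ut-upper-pointwise : ∀ q a b c → ⟦ ltF a b ⟧ * (⟦ ltF b c ⟧ * (Yt q a b c * Hcount (mask₃ a b c))) ≤ y ^ h * (⟦ ltF a b ⟧ * (⟦ ltF b c ⟧ * Yt q a b c))
    Ut-upper-pointwise q a b c with ltF a b in e1 | ltF b c in e2
    ... | false | _ = z≤n
    ... | true | false = z≤n
    ... | true | true = ≤-trans (≤-reflexive (r1 (Yt q a b c) (Hcount (mask₃ a b c))))
         (≤-trans (*-monoʳ-≤ (Yt q a b c) (≤-trans (Hcount-upper (mask₃ a b c)) (≤-reflexive (cong (y ^_) (nHigh-triple a b c e1 e2)))))
           (≤-reflexive (r2 (Yt q a b c) (y ^ h))))
      where
      r1 : ∀ Y H → 1 * (1 * (Y * H)) ≡ Y * H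
      r1 = solve-∀
      r2 : ∀ Y A → Y * A ≡ A * (1 * (1 * Y))
      r2 = solve-∀

    Ut-upper : ∀ q → Ut q ≤ y ^ h * Xt q
    Ut-upper q = ≤-trans (Σ³-mono (Ut-upper-pointwise q)) (≤-reflexive (Σ³-*ˡ {n} (y ^ h) _))

  three-vertices : ∀ q → 0 < Xt q → ∃ λ h → 3 + h ≡ n
  three-vertices q pos =
    let (a , p1) = Σ-pos _ pos
        (b , p2) = Σ-pos _ p1
        (c , p3) = Σ-pos _ p2
    in nHigh (mask₃ a b c) , nHigh₃ a b c (⟦⟧-pos (ltF a b) _ p3) (⟦⟧-pos (ltF b c) _ (*-pos ⟦ ltF a b ⟧ _ p3))

  triple-loses : ∀ r rs → IsKRestraint k r → IsKRestraint k rs → IsProperRestraint G r → IsProperRestraint G rs →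
    negA7'' G rs < negA7'' G r → suc K ^ n + n * n * negA7'' G r ≤ y' → πr G rs (K + y) < πr G r (K + y)
  triple-loses r rs kr krs pr prs lt big =
    core (proj₁ triple) (proj₂ triple)
   where
   triple : ∃ λ h → 3 + h ≡ n
   triple = three-vertices r (≤-trans (s≤s z≤n) (subst (suc (negA7'' G rs) ≤_) (negX r) lt))
   core : ∀ h → 3 + h ≡ n → πr G rs (K + y) < πr G r (K + y)
   core h nh = subst₂ _<_ (sym (expansion₃ rs)) (sym (expansion₃ r)) main
    where
    X1 : ℕ
    X1 = Xt r
    X2 : ℕ
    X2 = Xt rs
    lt' : suc X2 ≤ X1
    lt' = subst₂ (λ u v → suc u ≤ v) (negX rs) (negX r) lt
    big' : suc K ^ n + n * n * X1 ≤ y'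
    big' = subst (λ t → suc K ^ n + n * n * t ≤ y') (negX r) big
    key : Rest 3 rs + Ut rs < Ut r
    key = dominant-difference-wins y' h (suc K ^ n) (n * n) X1 X2 (Ut r) (Ut rs) (Rest 3 rs)
             (Ut-lower h nh r) (Ut-upper h nh rs) (Rest-bound′ 3 h rs nh) lt' big'
    P3< : P3 rs + Rest 3 rs < P3 r
    P3< = +-cancelʳ-< (Ut rs) (P3 rs + Rest 3 rs) (P3 r)
            (subst (P3 rs + Rest 3 rs + Ut rs <_) (sym (P3+Ut-invariant r rs kr krs pr prs))
              (subst (_< P3 rs + Ut r) (sym (+-assoc (P3 rs) (Rest 3 rs) (Ut rs))) (+-monoʳ-< (P3 rs) key)))
    F0 : ℕ
    F0 = lowWeight rs (λ _ → zero)
    P12 : P1 rs + P2 rs ≡ P1 r + P2 r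
    P12 = cong₂ _+_ (P1-eq rs r krs kr)
      (trans (sym (+-identityʳ (P2 rs))) (trans (cong (P2 rs +_) (sym (clashTerm-proper rs prs)))
        (trans (P2+clashTerm-invariant rs r krs kr) (trans (cong (P2 r +_) (clashTerm-proper r pr)) (+-identityʳ (P2 r))))))
    main : F0 + P1 rs + P2 rs + P3 rs + Rest 3 rs < F0 + P1 r + P2 r + P3 r + Rest 3 r
    main = ≤-trans (≤-reflexive (cong suc (r1 F0 (P1 rs) (P2 rs) (P3 rs) (Rest 3 rs))))
           (≤-trans (+-monoʳ-< (F0 + (P1 rs + P2 rs)) P3<)
             (≤-trans (≤-reflexive (trans (cong (λ t → F0 + t + P3 r) P12) (cong (_+ P3 r) (sym (+-assoc F0 (P1 r) (P2 r)))))) (m≤m+n (F0 + P1 r + P2 r + P3 r) (Rest 3 r))))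
      where
      r1 : ∀ a b c d e → a + b + c + d + e ≡ a + (b + c) + (d + e)
      r1 = solve-∀

Σ-combine : ∀ m n (f : Fin (m * n) → ℕ) → Σᶠ f ≡ Σᶠ (λ i → Σᶠ (λ j → f (combine {m} {n} i j)))
Σ-combine zero n f = refl
Σ-combine (suc m) n f = trans (Σ-split n (m * n) f) (cong (Σᶠ (λ j → f (j ↑ˡ (m * n))) +_) (Σ-combine m n (λ t → f (n ↑ʳ t))))

-- A proper k-restraint exists: vertex v forbids the k colours j ≡ v (mod n).
module ProperRestraintExists {n} (G : Graph n) (k : ℕ) where
  rp : Restraint n k
  rp = restraint (λ v → tabulate (λ j → eqF (remainder {k} n j) v))

  remc : ∀ i w → remainder {k} n (combine i w) ≡ w
  remc i w = cong proj₂ (remQuot-combine {k} {n} i w)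

  rp-k : IsKRestraint k rp
  rp-k v = trans (card (forb rp v)) (trans (Σ-cong {k * n} {λ α → ⟦ lookup (forb rp v) α ⟧} {λ j → ⟦ eqF (remainder {k} n j) v ⟧} (λ j → cong ⟦_⟧ (lookup∘tabulate (λ j → eqF (remainder {k} n j) v) j)))
    (trans (Σ-combine k n (λ j → ⟦ eqF (remainder {k} n j) v ⟧))
      (trans (Σ-cong (λ i → trans (Σ-cong (λ w → cong (λ t → ⟦ eqF t v ⟧) (remc i w))) (Σ-indicator v)))
         (trans (Σ-const k 1) (*-identityʳ k)))))

  rp-proper : IsProperRestraint G rp
  rp-proper u v e = trans (card∩ (forb rp u) (forb rp v)) (Σ-zero (λ j → cong ⟦_⟧ (trans (cong₂ _∧_ (lookup∘tabulate (λ j → eqF (remainder {k} n j) u) j) (lookup∘tabulate (λ j → eqF (remainder {k} n j) v) j)) (f (remainder {k} n j)))))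
    where
    f : ∀ t → eqF t u ∧ eqF t v ≡ false
    f t with eqF t u in e1 | eqF t v in e2
    ... | false | _ = refl
    ... | true | false = refl
    ... | true | true = ⊥-elim (adj-distinct G e (trans (sym (eqF-true t u e1)) (eqF-true t v e2)))

not-eventually-below : ∀ (f g : ℕ → ℕ) K B → (∃ λ N → ∀ x → x ≥ N → f x ≥ g x) →
  ¬ (∀ y' → B ≤ y' → f (K + suc y') < g (K + suc y'))
not-eventually-below f g K B (N , dom) below =
  <⇒≱ (below (N + B) (m≤n+m B N)) (dom (K + suc (N + B)) x≥N)
  where
  x≥N : K + suc (N + B) ≥ N
  x≥N = ≤-trans (m≤m+n N B) (≤-trans (n≤1+n (N + B)) (m≤n+m (suc (N + B)) K))

-- Part (i): a restraint in R_max(G,k) is proper.  A clash on an edge would make it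
-- lose, for all large x, against the proper k-restraint of the lemmas above.
Rmax-proper : ∀ {n} (G : Graph n) k (rs : Restraint n k) → InRmax G k rs → IsProperRestraint G rs
Rmax-proper {n} G k rs (krs , dom) u v uv with ∣ forb rs u ∩ forb rs v ∣ in clash
... | zero = refl
... | suc _ = ⊥-elim (not-eventually-below (πr G rs) (πr G rp) (k * n) (suc (k * n) ^ n + n * n)
      (dom rp (ProperRestraintExists.rp-k G k))
      (λ y' big → PartI.clash-loses G k y' rs rp krs (ProperRestraintExists.rp-k G k)
                    (ProperRestraintExists.rp-proper G k) u v uv (subst (1 ≤_) (sym clash) (s≤s z≤n)) big))
  where
  rp : Restraint n k
  rp = ProperRestraintExists.rp G k

Rmax-minimises-A7 : ∀ {n} (G : Graph n) k (rs : Restraint n k) → InRmax G k rs → IsProperRestraint G rs →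
  ∀ (r : Restraint n k) → IsKRestraint k r → IsProperRestraint G r → negA7'' G rs ≥ negA7'' G r
Rmax-minimises-A7 {n} G k rs (krs , dom) prs r kr pr with negA7'' G r ≤? negA7'' G rs
... | yes le = le
... | no nle = ⊥-elim (not-eventually-below (πr G rs) (πr G r) (k * n) (suc (k * n) ^ n + n * n * negA7'' G r)
      (dom r kr) (λ y' big → PartII.triple-loses G k y' r rs kr krs pr prs (≰⇒> nle) big))

theorem4p5 : ∀ {n} (G : Graph n) (k : ℕ) → 1 ≤ k → (rs : Restraint n k) → InRmax G k rs →
    IsProperRestraint G rs ×
    (∀ (r : Restraint n k) → IsKRestraint k r → IsProperRestraint G r → negA7'' G rs ≥ negA7'' G r)
theorem4p5 G k _ rs rmax = proper , Rmax-minimises-A7 G k rs rmax proper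
  where
  proper : IsProperRestraint G rs
  proper = Rmax-proper G k rs rmax
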